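{- Let $p$ be an odd prime and $\alpha\in\mathbb{Q}_p$. Let $(b_n)$ be the sequence of partial quotients produced on input $\alpha$ by either the First new algorithm or the Second new algorithm (defined in the context). Then, for every $n\geq 0$ for which the relevant partial quotients are defined, \[v_p(b_{3n+1})<0,\quad v_p(b_{3n+2})=0,\quad v_p(b_{3n+3})=0,\quad v_p(b_{3n+3}b_{3n+2}+1)=0.\]
   Context: Every $a\in\mathbb{Q}_p$ has a unique expansion $a=\sum_{n=-r}^{+\infty}a_np^n$ with digits $a_n\in\{0,\pm1,\ldots,\pm\frac{p-1}{2}\}$. Define $s(a)=\sum_{n=-r}^{0}a_np^n$, $t(a)=\sum_{n=-r}^{ -1}a_np^n$ (elements of $\mathbb{Q}$), and, when $a_0\neq 0,\pm$ defined, $u(a)=+1$ if $a_0\in\{2,\ldots,\frac{p-1}{2}\}\cup\{ -1\}$ and $u(a)=-1$ if $a_0\in\{ -\frac{p-1}{2},\ldots,-2\}\cup\{1\}$. $\mathrm{sign}$ is the usual sign of a nonzero rational number, and $v_p$ the $p$-adic valuation. First new algorithm: set $\alpha_0=\alpha$ and for $n\geq0$: if $n\equiv0\pmod 3$, $b_n=s(\alpha_n)$; if $n\equiv1\pmod3$, $b_n=t(\alpha_n)$ when $v_p(\alpha_n-t(\alpha_n))=0$ and $b_n=t(\alpha_n)-\mathrm{sign}(t(\alpha_n))$ when $v_p(\alpha_n-t(\alpha_n))\neq0$; if $n\equiv2\pmod3$, $b_n=u(\alpha_n)$; then $\alpha_{n+1}=\frac{1}{\alpha_n-b_n}$ (the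 algorithm stops if $\alpha_n=b_n$). Second new algorithm: identical, except that for $n\equiv2\pmod3$ one sets $b_n=s(\alpha_n)-u(\alpha_n)$. -}

module Defs where

open import Data.Nat as ℕ using (ℕ; zero; suc; NonZero)
open import Data.Nat.Base using (_≤ᵇ_)
open import Data.Integer as ℤ using (ℤ; +_; -[1+_]; +[1+_]; 0ℤ; 1ℤ; -1ℤ)
open import Data.Integer.DivMod using (_/ℕ_; _%ℕ_)
open import Data.Integer.Divisibility using (_∣_)
open import Data.Bool using (if_then_else_)
open import Data.Maybe using (Maybe; just; nothing)
open import Data.Product using (Σ; _×_)
open import Relation.Nullary using (¬_)
open import Relation.Binary.PropositionalEquality using (_≡_)

pℤ : ℕ → ℕ → ℤ
pℤ p k = + (p ℕ.^ k)

-- x mod d in [0, d) (junk value 0 for d = 0, never used since p^k ≥ 1)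
modN : ℤ → ℕ → ℕ
modN x zero    = 0
modN x (suc d) = x %ℕ suc d

-- exact integer division by d (junk 0 for d = 0)
divN : ℤ → ℕ → ℤ
divN x zero    = 0ℤ
divN x (suc d) = x /ℕ suc d

-- balanced representative of x modulo an odd q : the unique integer
-- congruent to x mod q lying in [-(q-1)/2, (q-1)/2]
bal : ℕ → ℤ → ℤ
bal q x = let m = modN x q in
  if m ≤ᵇ ℕ._/_ q 2 then + m else (+ m) ℤ.- (+ q)

sumTo : ℕ → (ℕ → ℤ) → ℤ
sumTo zero    f = 0ℤ
sumTo (suc n) f = sumTo n f ℤ.+ f n

-- An element of ℚ_p is represented as p^(-shift) · X with X ∈ ℤ_p, and
-- X ∈ ℤ_p is represented by a coherent sequence of residues:
-- X_k is X modulo p^k, with X_(k+1) ≡ X_k (mod p^k).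

record Qp : Set where
  constructor qp
  field
    shift : ℕ
    seq   : ℕ → ℤ
open Qp public

Coherent : ℕ → Qp → Set
Coherent p x = ∀ k → pℤ p k ∣ (seq x (suc k) ℤ.- seq x k)

-- equality in ℚ_p : p^(-r) X = p^(-s) Y  iff  p^s X = p^r Y in ℤ_p
_≈[_]_ : Qp → ℕ → Qp → Set
x ≈[ p ] y = ∀ k → pℤ p k ∣ (pℤ p (shift y) ℤ.* seq x k ℤ.- pℤ p (shift x) ℤ.* seq y k)

mulQ : Qp → Qp → Qp
mulQ x y = qp (shift x ℕ.+ shift y) (λ k → seq x k ℤ.* seq y k)

subQ : ℕ → Qp → Qp → Qp
subQ p x y = qp (shift x ℕ.+ shift y)
  (λ k → pℤ p (shift y) ℤ.* seq x k ℤ.- pℤ p (shift x) ℤ.* seq y k)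

-- Rationals whose denominator is a power of p: N / p^e.
-- (All partial quotients b_n of the algorithms are of this form.)

record Dy : Set where
  constructor dy
  field
    num : ℤ
    dexp : ℕ
open Dy public

ι : Dy → Qp
ι b = qp (dexp b) (λ _ → num b)

oneQ : Qp
oneQ = ι (dy 1ℤ 0)

mulDy : Dy → Dy → Dy
mulDy a b = dy (num a ℤ.* num b) (dexp a ℕ.+ dexp b)

addIntDy : ℕ → Dy → ℤ → Dy
addIntDy p b z = dy (num b ℤ.+ z ℤ.* pℤ p (dexp b)) (dexp b)

ValDy : ℕ → Dy → ℤ → Set
ValDy p b k = Σ ℕ λ m → (pℤ p m ∣ num b) × ¬ (pℤ p (suc m) ∣ num b)
                       × ((+ m) ℤ.- (+ dexp b) ≡ k)

-- p-adic valuation on ℚ_p :  v_p(x) = k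
-- (v_p(X) = m for X ∈ ℤ_p iff p^m divides X mod p^(m+1), p^(m+1) does not)
ValQp : ℕ → Qp → ℤ → Set
ValQp p x k = Σ ℕ λ m → (pℤ p m ∣ seq x (suc m)) × ¬ (pℤ p (suc m) ∣ seq x (suc m))
                       × ((+ m) ℤ.- (+ shift x) ≡ k)

-- For X ∈ ℤ_p, Tr k X = Σ_{j<k} d_j p^j is the balanced
-- representative of X mod p^k, and d_j = (Tr (j+1) X - Tr j X) / p^j.
-- For α = p^(-r) X, the digit a_n of α (n ≥ -r) is d_(n+r) of X.

Tr : ℕ → ℕ → Qp → ℤ
Tr p k x = bal (p ℕ.^ k) (seq x k)

digitX : ℕ → Qp → ℕ → ℤ
digitX p x j = divN (Tr p (suc j) x ℤ.- Tr p j x) (p ℕ.^ j)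

a₀ : ℕ → Qp → ℤ
a₀ p x = digitX p x (shift x)

-- s(α) = Σ_{n=-r}^{0} a_n p^n = (Σ_{j=0}^{r} d_j p^j) / p^r
sQ : ℕ → Qp → Dy
sQ p x = dy (sumTo (suc (shift x)) (λ j → digitX p x j ℤ.* pℤ p j)) (shift x)

-- t(α) = Σ_{n=-r}^{-1} a_n p^n = (Σ_{j=0}^{r-1} d_j p^j) / p^r
tQ : ℕ → Qp → Dy
tQ p x = dy (sumTo (shift x) (λ j → digitX p x j ℤ.* pℤ p j)) (shift x)

-- sign of a nonzero integer (value at 0 irrelevant: only used when ≠ 0)
sgn : ℤ → ℤ
sgn (+ zero)  = 0ℤ
sgn +[1+ _ ]  = 1ℤ
sgn -[1+ _ ]  = -1ℤ

-- u from the digit a_0 : +1 on {2..(p-1)/2} ∪ {-1}, -1 on {-(p-1)/2..-2} ∪ {1},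
-- undefined when a_0 = 0
uDigit : ℤ → Maybe ℤ
uDigit (+ zero)          = nothing
uDigit (+ suc zero)      = just -1ℤ
uDigit (+ suc (suc _))   = just 1ℤ
uDigit -[1+ zero ]       = just 1ℤ
uDigit -[1+ suc _ ]      = just -1ℤ

uQ : ℕ → Qp → Maybe ℤ
uQ p x = uDigit (a₀ p x)

data Alg : Set where
  first second : Alg

-- PQ p alg n α b : b is the partial quotient b_n computed from α_n = α
data PQ (p : ℕ) : Alg → ℕ → Qp → Dy → Set where
  pq0  : ∀ {alg n α} → n ℕ.% 3 ≡ 0 → PQ p alg n α (sQ p α)
  pq1a : ∀ {alg n α} → n ℕ.% 3 ≡ 1 →
         ValQp p (subQ p α (ι (tQ p α))) 0ℤ →
         PQ p alg n α (tQ p α)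
  pq1b : ∀ {alg n α} → n ℕ.% 3 ≡ 1 →
         ¬ ValQp p (subQ p α (ι (tQ p α))) 0ℤ →
         ¬ (num (tQ p α) ≡ 0ℤ) →
         PQ p alg n α (addIntDy p (tQ p α) (ℤ.- sgn (num (tQ p α))))
  pq2f : ∀ {n α e} → n ℕ.% 3 ≡ 2 → uQ p α ≡ just e →
         PQ p first n α (dy e 0)
  pq2s : ∀ {n α e} → n ℕ.% 3 ≡ 2 → uQ p α ≡ just e →
         PQ p second n α (addIntDy p (sQ p α) (ℤ.- e))

-- Run p alg α n αₙ : running the algorithm on α, the n-th complete quotient
-- αₙ is defined (α₀ = α; α_{n+1} = 1/(αₙ - bₙ), provided αₙ ≠ bₙ).
data Run (p : ℕ) (alg : Alg) (α : Qp) : ℕ → Qp → Set where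
  start : Run p alg α 0 α
  next  : ∀ {n a a' b} → Run p alg α n a → PQ p alg n a b →
          ¬ (a ≈[ p ] ι b) → Coherent p a' →
          mulQ a' (subQ p a (ι b)) ≈[ p ] oneQ →
          Run p alg α (suc n) a'

-- The p-adic numbers α_n are handled through their balanced truncations, so that the partial
-- quotients s, t, u become explicit integers and every claim becomes a congruence modulo a power
-- of p. The three steps of a period behave as follows. Subtracting b_{3n} = s(α_{3n}) leaves an
-- element of pℤ_p, so α_{3n+1} ∉ ℤ_p and the numerator of t(α_{3n+1}) is not divisible by the
-- denominator: v(b_{3n+1}) < 0. The test on v(α_{3n+1} - t(α_{3n+1})) is exactly a₀ ≠ 0, and in
-- both branches α_{3n+1} - b_{3n+1} is a unit (≡ a₀, resp. ≡ ± 1 mod p), hence so is its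
-- reciprocal α_{3n+2}. For a unit x with leading digit d, u(x) = e is chosen with d - e and e
-- both prime to p, so b_{3n+2} ≡ e or d - e (mod p) and α_{3n+2} - b_{3n+2} are units, and
-- α_{3n+3} is a unit with leading digit d′ ≡ (d - b_{3n+2})⁻¹. Then b_{3n+3} = s(α_{3n+3}) ≡ d′ and
-- b_{3n+3} b_{3n+2} + 1 ≡ d′ (b_{3n+2} + (d - b_{3n+2})) = d′ d (mod p) are units. Since the
-- statement quantifies over two runs separately, the last step also needs that the algorithm is
-- deterministic up to equality in ℚ_p.
module Submission where

open import Data.Bool using (true; false; T)
open import Data.Integer as ℤ using (ℤ; +_; -[1+_]; +[1+_]; 0ℤ; 1ℤ; -1ℤ; _+_; _*_; _-_; -_; ∣_∣)
import Data.Integer.DivMod as ℤDM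
import Data.Integer.Divisibility as ℤU
open import Data.Integer.Divisibility.Signed
  using (_∣_; divides; ∣-refl; ∣-trans; ∣⇒∣ᵤ; ∣ᵤ⇒∣; ∣m∣n⇒∣m+n; ∣m∣n⇒∣m-n; ∣m⇒∣-m; ∣n⇒∣m*n)
import Data.Integer.Divisibility.Signed as ℤD
import Data.Integer.Properties as ℤP
open import Data.Integer.Tactic.RingSolver using (solve)
open import Data.List.Base using (_∷_; [])
open import Data.Maybe using (just)
open import Data.Maybe.Properties using (just-injective)
open import Data.Nat as ℕ using (ℕ; zero; suc; NonZero; _≤ᵇ_)
import Data.Nat.Divisibility as ℕD
import Data.Nat.DivMod as ℕDM
open import Data.Nat.Primality using (Prime; euclidsLemma; prime⇒nonZero; prime⇒nonTrivial)
import Data.Nat.Properties as ℕP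
import Data.Nat.Tactic.RingSolver as ℕS
open import Data.Product using (Σ; _×_; _,_; proj₁; proj₂)
open import Data.Sum as Sum using (_⊎_; inj₁; inj₂)
open import Data.Unit using (tt)
open import Function using (case_of_; _∘_)
open import Level using (0ℓ)
open import Relation.Binary.Bundles using (Setoid)
open import Relation.Binary.PropositionalEquality
import Relation.Binary.Reasoning.Setoid as SetoidReasoning
open import Relation.Nullary using (¬_; Dec; yes; no; contradiction)
import Relation.Nullary.Decidable as Dec

open import Defs

odd⇒≡1+2*half : ∀ {q} → q ℕ.% 2 ≡ 1 → q ≡ suc (2 ℕ.* (q ℕ./ 2))
odd⇒≡1+2*half {q} odd = trans (ℕDM.m≡m%n+[m/n]*n q 2) (cong₂ ℕ._+_ odd (ℕP.*-comm (q ℕ./ 2) 2))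

%ℕ-congruent : ∀ q x → + suc q ∣ + (x ℤDM.%ℕ suc q) - x
%ℕ-congruent q x =
  divides (- (x ℤDM./ℕ suc q)) (lemma (+ (x ℤDM.%ℕ suc q)) (x ℤDM./ℕ suc q) (+ suc q) (ℤDM.a≡a%ℕn+[a/ℕn]*n x (suc q)))
  where lemma : ∀ r d Q {x} → x ≡ r + d * Q → r - x ≡ - d * Q
        lemma r d Q refl = solve (r ∷ d ∷ Q ∷ [])

bal-congruent : ∀ q .{{_ : NonZero q}} x → + q ∣ bal q x - x
bal-congruent (suc q) x with x ℤDM.%ℕ suc q ≤ᵇ suc q ℕ./ 2
... | true  = %ℕ-congruent q x
... | false = subst (+ suc q ∣_) (lemma (+ (x ℤDM.%ℕ suc q)) x (+ suc q)) (∣m∣n⇒∣m-n (%ℕ-congruent q x) ∣-refl)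
  where lemma : ∀ r x Q → r - x - Q ≡ r - Q - x
        lemma r x Q = solve (r ∷ x ∷ Q ∷ [])

bal-bound : ∀ {q} → q ℕ.% 2 ≡ 1 → ∀ x → 2 ℕ.* ∣ bal q x ∣ ℕ.< q
bal-bound {suc q} odd x with x ℤDM.%ℕ suc q ≤ᵇ suc q ℕ./ 2 in test
... | true  = subst (2 ℕ.* r ℕ.<_) (sym q≡) (ℕ.s≤s (ℕP.*-monoʳ-≤ 2 r≤h))
  where
  r = x ℤDM.%ℕ suc q; h = suc q ℕ./ 2
  q≡ = odd⇒≡1+2*half odd
  r≤h : r ℕ.≤ h
  r≤h = ℕP.≤ᵇ⇒≤ r h (subst T (sym test) tt)
... | false = begin-strict
    2 ℕ.* ∣ + r - + suc q ∣ ≡⟨ cong (2 ℕ.*_) (trans (cong ∣_∣ (ℤP.m-n≡m⊖n r (suc q))) (ℤP.∣⊖∣-< r<q)) ⟩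
    2 ℕ.* (suc q ℕ.∸ r)     ≤⟨ ℕP.*-monoʳ-≤ 2 (ℕP.∸-monoʳ-≤ (suc q) h<r) ⟩
    2 ℕ.* (suc q ℕ.∸ suc h) ≡⟨ cong (λ n → 2 ℕ.* (n ℕ.∸ suc h)) q≡ ⟩
    2 ℕ.* (2 ℕ.* h ℕ.∸ h)   ≡⟨ cong (2 ℕ.*_) (trans (ℕP.m+n∸m≡n h (h ℕ.+ 0)) (ℕP.+-identityʳ h)) ⟩
    2 ℕ.* h                 <⟨ ℕP.n<1+n _ ⟩
    suc (2 ℕ.* h)           ≡⟨ sym q≡ ⟩
    suc q                   ∎
  where
  open ℕP.≤-Reasoning
  r = x ℤDM.%ℕ suc q; h = suc q ℕ./ 2
  q≡ = odd⇒≡1+2*half odd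
  h<r : h ℕ.< r
  h<r = ℕP.≰⇒> (λ r≤h → subst T test (ℕP.≤⇒≤ᵇ r≤h))
  r<q : r ℕ.< suc q
  r<q = ℤDM.n%ℕd<d x (suc q)

∣∧∣∣<⇒≡0 : ∀ {q y} → + q ∣ y → ∣ y ∣ ℕ.< q → y ≡ 0ℤ
∣∧∣∣<⇒≡0 {q} {y} q∣y ∣y∣<q with ∣ y ∣ in ∣y∣≡
... | zero  = ℤP.∣i∣≡0⇒i≡0 ∣y∣≡
... | suc _ = contradiction (subst (q ℕD.∣_) ∣y∣≡ (∣⇒∣ᵤ q∣y)) (ℕD.>⇒∤ ∣y∣<q)

divN-exact : ∀ q .{{_ : NonZero q}} {x} → + q ∣ x → divN x q * + q ≡ x
divN-exact (suc q) {x} q∣x = sym (begin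
    x             ≡⟨ ℤDM.a≡a%ℕn+[a/ℕn]*n x (suc q) ⟩
    + r + d * Q   ≡⟨ cong (_+ d * Q) r≡0 ⟩
    0ℤ + d * Q    ≡⟨ ℤP.+-identityˡ (d * Q) ⟩
    d * Q         ∎)
  where
  open ≡-Reasoning
  Q = + suc q; r = x ℤDM.%ℕ suc q; d = x ℤDM./ℕ suc q
  r≡0 : + r ≡ 0ℤ
  r≡0 = ∣∧∣∣<⇒≡0 (subst (Q ∣_) (lemma (+ r) x) (∣m∣n⇒∣m+n (%ℕ-congruent q x) q∣x)) (ℤDM.n%ℕd<d x (suc q))
    where lemma : ∀ r x → r - x + x ≡ r
          lemma r x = solve (r ∷ x ∷ [])

m<n⇒m-n<0 : ∀ {m n} → m ℕ.< n → + m - + n ℤ.< 0ℤ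
m<n⇒m-n<0 {m} {n} m<n = subst (+ m - + n ℤ.<_) (ℤP.+-inverseʳ (+ n)) (ℤP.+-monoˡ-< (- + n) (ℤ.+<+ m<n))

module PowerCongruence (p : ℕ) ⦃ p≢0 : NonZero p ⦄ where

  infix 8 p^_
  p^_ : ℕ → ℤ
  p^ k = pℤ p k

  p^≢0 : ∀ k → ℤ.NonZero (p^ k)
  p^≢0 k = ℕP.m^n≢0 p k

  p^-+ : ∀ i j → p^ (i ℕ.+ j) ≡ p^ i * p^ j
  p^-+ i j = trans (cong +_ (ℕP.^-distribˡ-+-* p i j)) (ℤP.pos-* (p ℕ.^ i) (p ℕ.^ j))

  infix 4 _≡_[p^_]
  record _≡_[p^_] (x y : ℤ) (k : ℕ) : Set where
    constructor congruent
    field divides-difference : p^ k ∣ x - y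
  open _≡_[p^_] public

  module _ {k : ℕ} where

    ≡⇒≡[p^] : ∀ {x y} → x ≡ y → x ≡ y [p^ k ]
    ≡⇒≡[p^] {x} refl = congruent (divides 0ℤ (ℤP.+-inverseʳ x))

    ≡[p^]-refl : ∀ {x} → x ≡ x [p^ k ]
    ≡[p^]-refl = ≡⇒≡[p^] refl

    ≡[p^]-sym : ∀ {x y} → x ≡ y [p^ k ] → y ≡ x [p^ k ]
    ≡[p^]-sym {x} {y} (congruent d) = congruent (subst (p^ k ∣_) (lemma x y) (∣m⇒∣-m d))
      where lemma : ∀ x y → - (x - y) ≡ y - x
            lemma x y = solve (x ∷ y ∷ [])

    ≡[p^]-trans : ∀ {x y z} → x ≡ y [p^ k ] → y ≡ z [p^ k ] → x ≡ z [p^ k ]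
    ≡[p^]-trans {x} {y} {z} (congruent d) (congruent e) =
      congruent (subst (p^ k ∣_) (ℤP.+-minus-telescope x y z) (∣m∣n⇒∣m+n d e))

    +-cong : ∀ {x y u v} → x ≡ y [p^ k ] → u ≡ v [p^ k ] → x + u ≡ y + v [p^ k ]
    +-cong {x} {y} {u} {v} (congruent d) (congruent e) =
      congruent (subst (p^ k ∣_) (lemma x y u v) (∣m∣n⇒∣m+n d e))
      where lemma : ∀ x y u v → (x - y) + (u - v) ≡ (x + u) - (y + v)
            lemma x y u v = solve (x ∷ y ∷ u ∷ v ∷ [])

    -‿cong : ∀ {x y} → x ≡ y [p^ k ] → - x ≡ - y [p^ k ]
    -‿cong {x} {y} (congruent d) = congruent (subst (p^ k ∣_) (lemma x y) (∣m⇒∣-m d))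
      where lemma : ∀ x y → - (x - y) ≡ - x - - y
            lemma x y = solve (x ∷ y ∷ [])

    –-cong : ∀ {x y u v} → x ≡ y [p^ k ] → u ≡ v [p^ k ] → x - u ≡ y - v [p^ k ]
    –-cong c d = +-cong c (-‿cong d)

    *-congˡ : ∀ z {x y} → x ≡ y [p^ k ] → z * x ≡ z * y [p^ k ]
    *-congˡ z {x} {y} (congruent d) = congruent (subst (p^ k ∣_) (lemma z x y) (∣n⇒∣m*n z d))
      where lemma : ∀ z x y → z * (x - y) ≡ z * x - z * y
            lemma z x y = solve (z ∷ x ∷ y ∷ [])

    *-congʳ : ∀ z {x y} → x ≡ y [p^ k ] → x * z ≡ y * z [p^ k ]
    *-congʳ z {x} {y} c = subst₂ _≡_[p^ k ] (ℤP.*-comm z x) (ℤP.*-comm z y) (*-congˡ z c)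

    *-cong : ∀ {x y u v} → x ≡ y [p^ k ] → u ≡ v [p^ k ] → x * u ≡ y * v [p^ k ]
    *-cong {y = y} {u = u} c d = ≡[p^]-trans (*-congʳ u c) (*-congˡ y d)

    p^*≡0 : ∀ x → p^ k * x ≡ 0ℤ [p^ k ]
    p^*≡0 x = congruent (divides x (trans (ℤP.+-identityʳ (p^ k * x)) (ℤP.*-comm (p^ k) x)))

  ≡[p^]-setoid : ℕ → Setoid 0ℓ 0ℓ
  ≡[p^]-setoid k = record
    { Carrier       = ℤ
    ; _≈_           = _≡_[p^ k ]
    ; isEquivalence = record { refl = ≡[p^]-refl ; sym = ≡[p^]-sym ; trans = ≡[p^]-trans }
    }

  module ≡[p^]-Reasoning (k : ℕ) = SetoidReasoning (≡[p^]-setoid k)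

  ≡[p^]-cast : ∀ {j k x y} → j ≡ k → x ≡ y [p^ j ] → x ≡ y [p^ k ]
  ≡[p^]-cast refl c = c

  ≡[p^]-weaken : ∀ {j k x y} → j ℕ.≤ k → x ≡ y [p^ k ] → x ≡ y [p^ j ]
  ≡[p^]-weaken {j} {k} j≤k (congruent d) = congruent (∣-trans p^j∣p^k d)
    where p^j∣p^k : p^ j ∣ p^ k
          p^j∣p^k = divides (p^ (k ℕ.∸ j))
            (trans (cong p^_ (sym (ℕP.m∸n+n≡m j≤k))) (p^-+ (k ℕ.∸ j) j))

  p^≡0 : ∀ k → p^ k ≡ 0ℤ [p^ k ]
  p^≡0 k = subst (_≡ 0ℤ [p^ k ]) (ℤP.*-identityʳ (p^ k)) (p^*≡0 1ℤ)

  ≡0[p^0] : ∀ x → x ≡ 0ℤ [p^ 0 ]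
  ≡0[p^0] x = congruent (divides x (trans (ℤP.+-identityʳ x) (sym (ℤP.*-identityʳ x))))

  ≡0⇒p^* : ∀ {k x} → x ≡ 0ℤ [p^ k ] → Σ ℤ λ q → x ≡ p^ k * q
  ≡0⇒p^* {k} {x} (congruent (divides q x-0≡qp^k)) =
    q , trans (sym (ℤP.+-identityʳ x)) (trans x-0≡qp^k (ℤP.*-comm q (p^ k)))

  *p^-cong : ∀ j {k x y} → x ≡ y [p^ k ] → p^ j * x ≡ p^ j * y [p^ j ℕ.+ k ]
  *p^-cong j {k} {x} {y} (congruent d) =
    congruent (subst₂ _∣_ (sym (p^-+ j k)) (lemma (p^ j) x y) (ℤD.*-monoʳ-∣ (p^ j) d))
    where lemma : ∀ z x y → z * (x - y) ≡ z * x - z * y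
          lemma z x y = solve (z ∷ x ∷ y ∷ [])

  *p^-cancel : ∀ j {k x y} → p^ j * x ≡ p^ j * y [p^ j ℕ.+ k ] → x ≡ y [p^ k ]
  *p^-cancel j {k} {x} {y} (congruent d) =
    congruent (ℤD.*-cancelˡ-∣ (p^ j) ⦃ p^≢0 j ⦄ (subst₂ _∣_ (p^-+ j k) (lemma (p^ j) x y) d))
    where lemma : ∀ z x y → z * x - z * y ≡ z * (x - y)
          lemma z x y = solve (z ∷ x ∷ y ∷ [])

  *p^-≡0 : ∀ j {k x} → x ≡ 0ℤ [p^ k ] → p^ j * x ≡ 0ℤ [p^ j ℕ.+ k ]
  *p^-≡0 j {x = x} c = subst (p^ j * x ≡_[p^ _ ]) (ℤP.*-zeroʳ (p^ j)) (*p^-cong j c)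

  *p^-≡0-cancel : ∀ j {k x} → p^ j * x ≡ 0ℤ [p^ j ℕ.+ k ] → x ≡ 0ℤ [p^ k ]
  *p^-≡0-cancel j {x = x} c = *p^-cancel j (subst (p^ j * x ≡_[p^ _ ]) (sym (ℤP.*-zeroʳ (p^ j))) c)

  ≡0⇒∣ᵤ : ∀ {k x} → x ≡ 0ℤ [p^ k ] → pℤ p k ℤU.∣ x
  ≡0⇒∣ᵤ {x = x} (congruent d) = ∣⇒∣ᵤ (subst (_ ∣_) (ℤP.+-identityʳ x) d)

  ∣ᵤ⇒≡0 : ∀ {k x} → pℤ p k ℤU.∣ x → x ≡ 0ℤ [p^ k ]
  ∣ᵤ⇒≡0 {x = x} d = congruent (subst (_ ∣_) (sym (ℤP.+-identityʳ x)) (∣ᵤ⇒∣ d))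

  ≡0?[p^_] : ∀ k x → Dec (x ≡ 0ℤ [p^ k ])
  ≡0?[p^ k ] x = Dec.map′ ∣ᵤ⇒≡0 ≡0⇒∣ᵤ (p ℕ.^ k ℕD.∣? ∣ x ∣)

  *-≡0 : ∀ {i j x y} → x ≡ 0ℤ [p^ i ] → y ≡ 0ℤ [p^ j ] → x * y ≡ 0ℤ [p^ i ℕ.+ j ]
  *-≡0 {i} {j} {x} {y} c d with ≡0⇒∣ᵤ c | ≡0⇒∣ᵤ d
  ... | c′ | d′ = ∣ᵤ⇒≡0 (subst₂ ℕD._∣_ (sym (ℕP.^-distribˡ-+-* p i j)) (sym (ℤP.abs-* x y)) (ℕD.*-pres-∣ c′ d′))

  ≡0∧small⇒≡0 : ∀ {k x} → x ≡ 0ℤ [p^ k ] → ∣ x ∣ ℕ.< p ℕ.^ k → x ≡ 0ℤ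
  ≡0∧small⇒≡0 c = ∣∧∣∣<⇒≡0 (∣ᵤ⇒∣ (≡0⇒∣ᵤ c))

  ≡[p^]∧small⇒≡ : ∀ {K u v} → u ≡ v [p^ K ] → 2 ℕ.* ∣ u ∣ ℕ.< p ℕ.^ K → 2 ℕ.* ∣ v ∣ ℕ.< p ℕ.^ K → u ≡ v
  ≡[p^]∧small⇒≡ {K} {u} {v} u≡v 2∣u∣< 2∣v∣< = ℤP.i-j≡0⇒i≡j u v (≡0∧small⇒≡0 u-v≡0 ∣u-v∣<)
    where
    u-v≡0 : u - v ≡ 0ℤ [p^ K ]
    u-v≡0 = congruent (subst (p^ K ∣_) (sym (ℤP.+-identityʳ (u - v))) (divides-difference u≡v))
    ∣u-v∣< : ∣ u - v ∣ ℕ.< p ℕ.^ K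
    ∣u-v∣< = ℕP.*-cancelˡ-< 2 _ _ (begin-strict
      2 ℕ.* ∣ u - v ∣               ≤⟨ ℕP.*-monoʳ-≤ 2 (ℤP.∣i-j∣≤∣i∣+∣j∣ u v) ⟩
      2 ℕ.* (∣ u ∣ ℕ.+ ∣ v ∣)       ≡⟨ ℕP.*-distribˡ-+ 2 ∣ u ∣ ∣ v ∣ ⟩
      2 ℕ.* ∣ u ∣ ℕ.+ 2 ℕ.* ∣ v ∣   <⟨ ℕP.+-mono-< 2∣u∣< 2∣v∣< ⟩
      p ℕ.^ K ℕ.+ p ℕ.^ K           ≡⟨ cong (p ℕ.^ K ℕ.+_) (sym (ℕP.+-identityʳ (p ℕ.^ K))) ⟩
      2 ℕ.* p ℕ.^ K                 ∎)
      where open ℕP.≤-Reasoning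

  *p^-bound : ∀ j {k T} → 2 ℕ.* ∣ T ∣ ℕ.< p ℕ.^ k → 2 ℕ.* ∣ p^ j * T ∣ ℕ.< p ℕ.^ (j ℕ.+ k)
  *p^-bound j {k} {T} 2∣T∣< = begin-strict
    2 ℕ.* ∣ p^ j * T ∣          ≡⟨ cong (2 ℕ.*_) (ℤP.abs-* (p^ j) T) ⟩
    2 ℕ.* (p ℕ.^ j ℕ.* ∣ T ∣)   ≡⟨ ℕP.*-comm 2 (p ℕ.^ j ℕ.* ∣ T ∣) ⟩
    p ℕ.^ j ℕ.* ∣ T ∣ ℕ.* 2     ≡⟨ ℕP.*-assoc (p ℕ.^ j) ∣ T ∣ 2 ⟩
    p ℕ.^ j ℕ.* (∣ T ∣ ℕ.* 2)   ≡⟨ cong (p ℕ.^ j ℕ.*_) (ℕP.*-comm ∣ T ∣ 2) ⟩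
    p ℕ.^ j ℕ.* (2 ℕ.* ∣ T ∣)   <⟨ ℕP.*-monoʳ-< (p ℕ.^ j) ⦃ ℕP.m^n≢0 p j ⦄ 2∣T∣< ⟩
    p ℕ.^ j ℕ.* p ℕ.^ k         ≡⟨ ℕP.^-distribˡ-+-* p j k ⟨
    p ℕ.^ (j ℕ.+ k)             ∎
    where open ℕP.≤-Reasoning

  coherent-≤ : ∀ {x} → Coherent p x → ∀ {j k} → j ℕ.≤ k → seq x k ≡ seq x j [p^ j ]
  coherent-≤ {x} coh {j} j≤k = go (ℕP.≤⇒≤′ j≤k)
    where
    go : ∀ {k} → j ℕ.≤′ k → seq x k ≡ seq x j [p^ j ]
    go (ℕ.≤′-reflexive refl) = ≡[p^]-refl
    go (ℕ.≤′-step {k} j≤′k) =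
      ≡[p^]-trans (≡[p^]-weaken (ℕP.≤′⇒≤ j≤′k) (congruent (∣ᵤ⇒∣ (coh k)))) (go j≤′k)

  ≈⇒≡[p^] : ∀ {x y} → x ≈[ p ] y → ∀ k → p^ shift y * seq x k ≡ p^ shift x * seq y k [p^ k ]
  ≈⇒≡[p^] x≈y k = congruent (∣ᵤ⇒∣ (x≈y k))

  ≡[p^]⇒≈ : ∀ {x y} → (∀ k → p^ shift y * seq x k ≡ p^ shift x * seq y k [p^ k ]) → x ≈[ p ] y
  ≡[p^]⇒≈ x≡y k = ∣⇒∣ᵤ (divides-difference (x≡y k))

  ≈-refl : ∀ {x} → x ≈[ p ] x
  ≈-refl {x} = ≡[p^]⇒≈ {x} {x} λ _ → ≡[p^]-refl

  subQ-cong : ∀ {x₁ x₂ y₁ y₂} → x₁ ≈[ p ] x₂ → y₁ ≈[ p ] y₂ → subQ p x₁ y₁ ≈[ p ] subQ p x₂ y₂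
  subQ-cong {x₁} {x₂} {y₁} {y₂} x₁≈x₂ y₁≈y₂ = ≡[p^]⇒≈ {subQ p x₁ y₁} {subQ p x₂ y₂} λ k →
    subst₂ (_≡_[p^ k ])
      (lemma₁ (p^ r₁) (p^ r₂) (p^ q₁) (p^ q₂) (seq x₁ k) (seq y₁ k) (p^-+ r₂ q₂))
      (lemma₂ (p^ r₁) (p^ r₂) (p^ q₁) (p^ q₂) (seq x₂ k) (seq y₂ k) (p^-+ r₁ q₁))
      (–-cong (*-congˡ (p^ q₂ * p^ q₁) (≈⇒≡[p^] {x₁} {x₂} x₁≈x₂ k)) (*-congˡ (p^ r₂ * p^ r₁) (≈⇒≡[p^] {y₁} {y₂} y₁≈y₂ k)))
    where
    r₁ = shift x₁; r₂ = shift x₂; q₁ = shift y₁; q₂ = shift y₂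
    lemma₁ : ∀ R₁ R₂ Q₁ Q₂ X Y {P} → P ≡ R₂ * Q₂ →
             Q₂ * Q₁ * (R₂ * X) - R₂ * R₁ * (Q₂ * Y) ≡ P * (Q₁ * X - R₁ * Y)
    lemma₁ R₁ R₂ Q₁ Q₂ X Y refl = solve (R₁ ∷ R₂ ∷ Q₁ ∷ Q₂ ∷ X ∷ Y ∷ [])
    lemma₂ : ∀ R₁ R₂ Q₁ Q₂ X Y {P} → P ≡ R₁ * Q₁ →
             Q₂ * Q₁ * (R₁ * X) - R₂ * R₁ * (Q₁ * Y) ≡ P * (Q₂ * X - R₂ * Y)
    lemma₂ R₁ R₂ Q₁ Q₂ X Y refl = solve (R₁ ∷ R₂ ∷ Q₁ ∷ Q₂ ∷ X ∷ Y ∷ [])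

  infix 4 _≃ᵈ_
  record _≃ᵈ_ (b₁ b₂ : Dy) : Set where
    constructor cross-equal
    field cross : p^ dexp b₂ * num b₁ ≡ p^ dexp b₁ * num b₂
  open _≃ᵈ_ public

  ≃ᵈ⇒ι≈ : ∀ {b₁ b₂} → b₁ ≃ᵈ b₂ → ι b₁ ≈[ p ] ι b₂
  ≃ᵈ⇒ι≈ {b₁} {b₂} (cross-equal b₁≃b₂) = ≡[p^]⇒≈ {ι b₁} {ι b₂} (λ k → ≡⇒≡[p^] b₁≃b₂)

  addInt-≃ᵈ : ∀ {b₁ b₂} z → b₁ ≃ᵈ b₂ → addIntDy p b₁ z ≃ᵈ addIntDy p b₂ z
  addInt-≃ᵈ {b₁} {b₂} z (cross-equal b₁≃b₂) = cross-equal (begin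
    P₂ * (N₁ + z * P₁)   ≡⟨ distrib P₂ N₁ z P₁ ⟩
    P₂ * N₁ + z * (P₁ * P₂) ≡⟨ cong₂ (λ u v → u + z * v) b₁≃b₂ (ℤP.*-comm P₁ P₂) ⟩
    P₁ * N₂ + z * (P₂ * P₁) ≡⟨ sym (distrib P₁ N₂ z P₂) ⟩
    P₁ * (N₂ + z * P₂)   ∎)
    where
    open ≡-Reasoning
    P₁ = p^ dexp b₁; P₂ = p^ dexp b₂; N₁ = num b₁; N₂ = num b₂
    distrib : ∀ P N z Q → P * (N + z * Q) ≡ P * N + z * (Q * P)
    distrib P N z Q = solve (P ∷ N ∷ z ∷ Q ∷ [])

  inverse-congruent : ∀ {a c} → mulQ a c ≈[ p ] oneQ → ∀ k →
                      seq a k * seq c k ≡ p^ (shift a ℕ.+ shift c) [p^ k ]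
  inverse-congruent a*c≈1 k =
    subst₂ (_≡_[p^ k ]) (ℤP.*-identityˡ _) (ℤP.*-identityʳ _) (congruent (∣ᵤ⇒∣ (a*c≈1 k)))

  inverses-cross : ∀ {K A B C D S₁ S₂ T₁ T₂} →
                   A * C ≡ S₁ * T₁ [p^ K ] → B * D ≡ S₂ * T₂ [p^ K ] → T₂ * C ≡ T₁ * D [p^ K ] →
                   T₁ * T₂ * (S₂ * A) ≡ T₁ * T₂ * (S₁ * B) [p^ K ]
  inverses-cross {K} {A} {B} {C} {D} {S₁} {S₂} {T₁} {T₂} A*C≡ B*D≡ T₂C≡T₁D = begin
    T₁ * T₂ * (S₂ * A)    ≡⟨ solve (T₁ ∷ T₂ ∷ S₂ ∷ A ∷ []) ⟩
    (T₁ * A) * (S₂ * T₂)  ≈⟨ *-congˡ (T₁ * A) B*D≡ ⟨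
    (T₁ * A) * (B * D)    ≡⟨ solve (T₁ ∷ A ∷ B ∷ D ∷ []) ⟩
    (A * B) * (T₁ * D)    ≈⟨ *-congˡ (A * B) T₂C≡T₁D ⟨
    (A * B) * (T₂ * C)    ≡⟨ solve (A ∷ B ∷ T₂ ∷ C ∷ []) ⟩
    (T₂ * B) * (A * C)    ≈⟨ *-congˡ (T₂ * B) A*C≡ ⟩
    (T₂ * B) * (S₁ * T₁)  ≡⟨ solve (T₂ ∷ B ∷ S₁ ∷ T₁ ∷ []) ⟩
    T₁ * T₂ * (S₁ * B)    ∎
    where open ≡[p^]-Reasoning K

  inverse-unique : ∀ {a₁ a₂ c₁ c₂} → Coherent p a₁ → Coherent p a₂ →
                   mulQ a₁ c₁ ≈[ p ] oneQ → mulQ a₂ c₂ ≈[ p ] oneQ → c₁ ≈[ p ] c₂ → a₁ ≈[ p ] a₂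
  inverse-unique {a₁} {a₂} {c₁} {c₂} coh₁ coh₂ a₁c₁≈1 a₂c₂≈1 c₁≈c₂ = ≡[p^]⇒≈ {a₁} {a₂} λ k →
    ≡[p^]-trans (*-congˡ S₂ (≡[p^]-sym (coherent-≤ {a₁} coh₁ (ℕP.m≤n+m k t))))
      (≡[p^]-trans (at-level k) (*-congˡ S₁ (coherent-≤ {a₂} coh₂ (ℕP.m≤n+m k t))))
    where
    s₁ = shift a₁; s₂ = shift a₂; t₁ = shift c₁; t₂ = shift c₂; t = t₁ ℕ.+ t₂
    S₁ = p^ s₁; S₂ = p^ s₂; T₁ = p^ t₁; T₂ = p^ t₂
    inverse≡ : ∀ {a c} → mulQ a c ≈[ p ] oneQ → ∀ K → seq a K * seq c K ≡ p^ shift a * p^ shift c [p^ K ]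
    inverse≡ {a} {c} ac≈1 K = subst (seq a K * seq c K ≡_[p^ K ]) (p^-+ (shift a) (shift c)) (inverse-congruent {a} {c} ac≈1 K)
    at-level : ∀ k → S₂ * seq a₁ (t ℕ.+ k) ≡ S₁ * seq a₂ (t ℕ.+ k) [p^ k ]
    at-level k = *p^-cancel t (subst₂ (_≡_[p^ t ℕ.+ k ]) (cong (_* (S₂ * A)) (sym (p^-+ t₁ t₂)))
                                                      (cong (_* (S₁ * B)) (sym (p^-+ t₁ t₂)))
                   (inverses-cross {K} {A} {B} {C} {D} {S₁} {S₂} {T₁} {T₂}
                     (inverse≡ {a₁} {c₁} a₁c₁≈1 K) (inverse≡ {a₂} {c₂} a₂c₂≈1 K) (≈⇒≡[p^] {c₁} {c₂} c₁≈c₂ K)))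
      where K = t ℕ.+ k; A = seq a₁ K; B = seq a₂ K; C = seq c₁ K; D = seq c₂ K

phase2-quotient : ℕ → Alg → Qp → ℤ → Dy
phase2-quotient p first  x e = dy e 0
phase2-quotient p second x e = addIntDy p (sQ p x) (- e)

phase-clash : ∀ {r i j : ℕ} {A : Set} → r ≡ i → r ≡ j → i ≢ j → A
phase-clash r≡i r≡j i≢j = contradiction (trans (sym r≡i) r≡j) i≢j

PQ-phase0 : ∀ {p alg n x b} → n ℕ.% 3 ≡ 0 → PQ p alg n x b → b ≡ sQ p x
PQ-phase0 _ (pq0 _)      = refl
PQ-phase0 h (pq1a h′ _)   = phase-clash h h′ λ ()
PQ-phase0 h (pq1b h′ _ _) = phase-clash h h′ λ ()
PQ-phase0 h (pq2f h′ _)   = phase-clash h h′ λ ()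
PQ-phase0 h (pq2s h′ _)   = phase-clash h h′ λ ()

PQ-phase2 : ∀ {p alg n x b} → n ℕ.% 3 ≡ 2 → PQ p alg n x b →
            Σ ℤ λ e → (uQ p x ≡ just e) × (b ≡ phase2-quotient p alg x e)
PQ-phase2 h (pq0 h′)       = phase-clash h h′ λ ()
PQ-phase2 h (pq1a h′ _)    = phase-clash h h′ λ ()
PQ-phase2 h (pq1b h′ _ _)  = phase-clash h h′ λ ()
PQ-phase2 _ (pq2f {e = e} _ u≡e) = e , u≡e , refl
PQ-phase2 _ (pq2s {e = e} _ u≡e) = e , u≡e , refl

[r+3n]%3≡r%3 : ∀ r n → (r ℕ.+ 3 ℕ.* n) ℕ.% 3 ≡ r ℕ.% 3
[r+3n]%3≡r%3 r n = trans (cong (λ k → (r ℕ.+ k) ℕ.% 3) (ℕP.*-comm 3 n)) (ℕDM.[m+kn]%n≡m%n r n 3)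

module OddPrime (p : ℕ) (p-prime : Prime p) (p-odd : p ℕ.% 2 ≡ 1) where

  instance
    p≢0 : NonZero p
    p≢0 = prime⇒nonZero p-prime

  open PowerCongruence p public

  1<p : 1 ℕ.< p
  1<p = ℕ.nonTrivial⇒n>1 p ⦃ prime⇒nonTrivial p-prime ⦄

  3≤p : 3 ℕ.≤ p
  3≤p = ℕP.≤∧≢⇒< 1<p (λ 2≡p → case subst (λ n → n ℕ.% 2 ≡ 1) (sym 2≡p) p-odd of λ ())

  p^-odd : ∀ k → p ℕ.^ k ℕ.% 2 ≡ 1
  p^-odd zero    = refl
  p^-odd (suc k) = trans (ℕDM.%-distribˡ-* p (p ℕ.^ k) 2)
                         (cong₂ (λ a b → (a ℕ.* b) ℕ.% 2) p-odd (p^-odd k))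

  p^[1+k]∤p^k : ∀ k → ¬ p^ k ≡ 0ℤ [p^ suc k ]
  p^[1+k]∤p^k k c = ℕD.>⇒∤ ⦃ ℕP.m^n≢0 p k ⦄ (ℕP.^-monoʳ-< p 1<p (ℕP.n<1+n k)) (≡0⇒∣ᵤ c)

  infix 4 p∤_
  p∤_ : ℤ → Set
  p∤ w = ¬ w ≡ 0ℤ [p^ 1 ]

  private
    ≡0[p]⇒p∣ : ∀ {x} → x ≡ 0ℤ [p^ 1 ] → p ℕD.∣ ∣ x ∣
    ≡0[p]⇒p∣ c = subst (ℕD._∣ _) (ℕP.*-identityʳ p) (≡0⇒∣ᵤ c)

    p∣⇒≡0[p] : ∀ {x} → p ℕD.∣ ∣ x ∣ → x ≡ 0ℤ [p^ 1 ]
    p∣⇒≡0[p] d = ∣ᵤ⇒≡0 (subst (ℕD._∣ _) (sym (ℕP.*-identityʳ p)) d)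

  *-≡0[p] : ∀ {x y} → x * y ≡ 0ℤ [p^ 1 ] → x ≡ 0ℤ [p^ 1 ] ⊎ y ≡ 0ℤ [p^ 1 ]
  *-≡0[p] {x} {y} c =
    Sum.map p∣⇒≡0[p] p∣⇒≡0[p] (euclidsLemma ∣ x ∣ ∣ y ∣ p-prime (subst (p ℕD.∣_) (ℤP.abs-* x y) (≡0[p]⇒p∣ c)))

  p∤-* : ∀ {x y} → p∤ x → p∤ y → p∤ (x * y)
  p∤-* p∤x p∤y c = Sum.[ p∤x , p∤y ]′ (*-≡0[p] c)

  p∤-small : ∀ {w} → 0 ℕ.< ∣ w ∣ → ∣ w ∣ ℕ.< p → p∤ w
  p∤-small {w} 0<∣w∣ ∣w∣<p c = ℕD.>⇒∤ ⦃ ℕ.>-nonZero 0<∣w∣ ⦄ ∣w∣<p (≡0[p]⇒p∣ c)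

  p∤1 : p∤ 1ℤ
  p∤1 = p∤-small (ℕ.s≤s ℕ.z≤n) 1<p

  p∤-1 : p∤ -1ℤ
  p∤-1 = p∤-small (ℕ.s≤s ℕ.z≤n) 1<p

  p∤-cong : ∀ {u w} → u ≡ w [p^ 1 ] → p∤ w → p∤ u
  p∤-cong u≡w p∤w w≡0 = p∤w (≡[p^]-trans (≡[p^]-sym u≡w) w≡0)

  p∤-invertible : ∀ {d w} → d * w ≡ 1ℤ [p^ 1 ] → p∤ d
  p∤-invertible {d} {w} dw≡1 d≡0 =
    p∤1 (≡[p^]-trans (≡[p^]-sym dw≡1) (subst (d * w ≡_[p^ 1 ]) (ℤP.*-zeroˡ w) (*-congʳ w d≡0)))

  p∤-cancel : ∀ {u} → p∤ u → ∀ j {a} → a * u ≡ 0ℤ [p^ j ] → a ≡ 0ℤ [p^ j ]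
  p∤-cancel p∤u zero {a} _ = ≡0[p^0] a
  p∤-cancel {u} p∤u (suc j) {a} au≡0
    with q , a≡p^jq ← ≡0⇒p^* (p∤-cancel p∤u j (≡[p^]-weaken (ℕP.n≤1+n j) au≡0)) =
    subst (_≡ 0ℤ [p^ suc j ]) (sym a≡p^jq) (≡[p^]-cast j+1≡1+j (*p^-≡0 j q≡0))
    where
    j+1≡1+j = ℕP.+-comm j 1
    qu≡0 : q * u ≡ 0ℤ [p^ 1 ]
    qu≡0 = *p^-≡0-cancel j (≡[p^]-cast (sym j+1≡1+j)
             (subst (_≡ 0ℤ [p^ suc j ]) (trans (cong (_* u) a≡p^jq) (ℤP.*-assoc (p^ j) q u)) au≡0))
    q≡0 : q ≡ 0ℤ [p^ 1 ]
    q≡0 with *-≡0[p] qu≡0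
    ... | inj₁ q≡0 = q≡0
    ... | inj₂ u≡0 = contradiction u≡0 p∤u

  leading-digit : ∀ {j x w} → x ≡ p^ j * w [p^ suc j ] → Σ ℤ λ u → (x ≡ p^ j * u) × (u ≡ w [p^ 1 ])
  leading-digit {j} {x} {w} (congruent (divides q x-p^jw≡qp^j+1)) =
    w + q * p^ 1 , x≡ , congruent (divides q (lemma w (q * p^ 1)))
    where
    lemma : ∀ w v → w + v - w ≡ v
    lemma w v = solve (w ∷ v ∷ [])
    x≡ : x ≡ p^ j * (w + q * p^ 1)
    x≡ = begin
      x                             ≡⟨ split x (p^ j * w) ⟩
      x - p^ j * w + p^ j * w       ≡⟨ cong (_+ p^ j * w) x-p^jw≡qp^j+1 ⟩
      q * p^ suc j + p^ j * w       ≡⟨ cong (λ P → q * P + p^ j * w) (trans (cong p^_ (ℕP.+-comm 1 j)) (p^-+ j 1)) ⟩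
      q * (p^ j * p^ 1) + p^ j * w  ≡⟨ distrib q (p^ j) (p^ 1) w ⟩
      p^ j * (w + q * p^ 1)         ∎
      where
      open ≡-Reasoning
      split : ∀ x y → x ≡ x - y + y
      split x y = solve (x ∷ y ∷ [])
      distrib : ∀ q P Q w → q * (P * Q) + P * w ≡ P * (w + q * Q)
      distrib q P Q w = solve (q ∷ P ∷ Q ∷ w ∷ [])

  sgn-p∤ : ∀ z → z ≢ 0ℤ → p∤ sgn z
  sgn-p∤ (+ zero)   z≢0 = contradiction refl z≢0
  sgn-p∤ +[1+ _ ]   _   = p∤1
  sgn-p∤ -[1+ _ ]   _   = p∤-1

  private
    2[2+n]<1+p⇒1+n<p : ∀ n → 2 ℕ.* suc (suc n) ℕ.< suc p → suc n ℕ.< p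
    2[2+n]<1+p⇒1+n<p n 2[2+n]<1+p = ℕP.≤-trans (ℕ.s≤s (ℕP.m≤m+n (suc n) _)) (ℕP.≤-pred 2[2+n]<1+p)

  u-p∤ : ∀ {d e} → uDigit d ≡ just e → p∤ e
  u-p∤ {+ suc zero}      refl = p∤-1
  u-p∤ {+ suc (suc _)}   refl = p∤1
  u-p∤ { -[1+ zero ]}    refl = p∤1
  u-p∤ { -[1+ suc _ ]}   refl = p∤-1

  digit-minus-u-p∤ : ∀ {d e} → 2 ℕ.* ∣ d ∣ ℕ.< suc p → uDigit d ≡ just e → p∤ (d - e)
  digit-minus-u-p∤ {+ suc zero}      _     refl = p∤-small (ℕ.s≤s ℕ.z≤n) 3≤p
  digit-minus-u-p∤ {+ suc (suc n)}   2d<1+p refl = p∤-small (ℕ.s≤s ℕ.z≤n) (2[2+n]<1+p⇒1+n<p n 2d<1+p)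
  digit-minus-u-p∤ { -[1+ zero ]}    _     refl = p∤-small (ℕ.s≤s ℕ.z≤n) 3≤p
  digit-minus-u-p∤ { -[1+ suc n ]}   2d<1+p refl = p∤-small (ℕ.s≤s ℕ.z≤n) (2[2+n]<1+p⇒1+n<p n 2d<1+p)

  -- Digits

  Tr-congruent : ∀ k x → Tr p k x ≡ seq x k [p^ k ]
  Tr-congruent k x = congruent (bal-congruent (p ℕ.^ k) ⦃ ℕP.m^n≢0 p k ⦄ (seq x k))

  Tr-bound : ∀ k x → 2 ℕ.* ∣ Tr p k x ∣ ℕ.< p ℕ.^ k
  Tr-bound k x = bal-bound (p^-odd k) (seq x k)

  Tr-≤ : ∀ {x} → Coherent p x → ∀ {j k} → j ℕ.≤ k → Tr p j x ≡ seq x k [p^ j ]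
  Tr-≤ {x} coh {j} j≤k = ≡[p^]-trans (Tr-congruent j x) (≡[p^]-sym (coherent-≤ {x} coh j≤k))

  Tr-≡0 : ∀ {k x} → Tr p k x ≡ 0ℤ [p^ k ] → Tr p k x ≡ 0ℤ
  Tr-≡0 {k} {x} c = ≡0∧small⇒≡0 c (ℕP.≤-<-trans (ℕP.m≤n*m ∣ Tr p k x ∣ 2) (Tr-bound k x))

  digit-telescopes : ∀ {x} → Coherent p x → ∀ j → digitX p x j * p^ j ≡ Tr p (suc j) x - Tr p j x
  digit-telescopes {x} coh j = divN-exact (p ℕ.^ j) ⦃ ℕP.m^n≢0 p j ⦄ (divides-difference Tr[1+j]≡Tr[j])
    where
    Tr[1+j]≡Tr[j] : Tr p (suc j) x ≡ Tr p j x [p^ j ]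
    Tr[1+j]≡Tr[j] = ≡[p^]-trans (≡[p^]-weaken (ℕP.n≤1+n j) (Tr-congruent (suc j) x))
                                (≡[p^]-sym (Tr-≤ {x} coh (ℕP.n≤1+n j)))

  digits-sum : ∀ {x} → Coherent p x → ∀ k → sumTo k (λ j → digitX p x j * p^ j) ≡ Tr p k x
  digits-sum {x} coh zero    = sym (Tr-≡0 {0} {x} (≡0[p^0] (Tr p 0 x)))
  digits-sum {x} coh (suc k) = begin
    sumTo k _ + digitX p x k * p^ k   ≡⟨ cong₂ _+_ (digits-sum {x} coh k) (digit-telescopes {x} coh k) ⟩
    Tr p k x + (Tr p (suc k) x - Tr p k x) ≡⟨ lemma (Tr p k x) (Tr p (suc k) x) ⟩
    Tr p (suc k) x                    ∎
    where
    open ≡-Reasoning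
    lemma : ∀ a b → a + (b - a) ≡ b
    lemma a b = solve (a ∷ b ∷ [])

  num-sQ : ∀ {x} → Coherent p x → num (sQ p x) ≡ Tr p (suc (shift x)) x
  num-sQ {x} coh = digits-sum {x} coh (suc (shift x))

  num-tQ : ∀ {x} → Coherent p x → num (tQ p x) ≡ Tr p (shift x) x
  num-tQ {x} coh = digits-sum {x} coh (shift x)

  num-tQ≡ : ∀ {x} → Coherent p x → num (tQ p x) ≡ Tr p (suc (shift x)) x - p^ shift x * a₀ p x
  num-tQ≡ {x} coh = begin
    num (tQ p x)           ≡⟨ num-tQ {x} coh ⟩
    T₀                     ≡⟨ lemma T₀ T₁ ⟩
    T₁ - (T₁ - T₀)         ≡⟨ cong (λ M → T₁ - M) (sym (digit-telescopes {x} coh r)) ⟩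
    T₁ - a₀ p x * p^ r     ≡⟨ cong (λ M → T₁ - M) (ℤP.*-comm (a₀ p x) (p^ r)) ⟩
    T₁ - p^ r * a₀ p x     ∎
    where
    open ≡-Reasoning
    r = shift x; T₀ = Tr p r x; T₁ = Tr p (suc r) x
    lemma : ∀ T₀ T₁ → T₀ ≡ T₁ - (T₁ - T₀)
    lemma T₀ T₁ = solve (T₀ ∷ T₁ ∷ [])

  a₀-bound : ∀ {x} → Coherent p x → 2 ℕ.* ∣ a₀ p x ∣ ℕ.< suc p
  a₀-bound {x} coh = ℕP.*-cancelʳ-< (p ℕ.^ r) (2 ℕ.* ∣ a₀ p x ∣) (suc p) (begin-strict
    2 ℕ.* ∣ a₀ p x ∣ ℕ.* p ℕ.^ r       ≡⟨ ℕP.*-assoc 2 ∣ a₀ p x ∣ (p ℕ.^ r) ⟩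
    2 ℕ.* (∣ a₀ p x ∣ ℕ.* p ℕ.^ r)     ≡⟨ cong (2 ℕ.*_) (trans (sym (ℤP.abs-* (a₀ p x) (p^ r)))
                                                                (cong ∣_∣ (digit-telescopes {x} coh r))) ⟩
    2 ℕ.* ∣ T₁ - T₀ ∣                   ≤⟨ ℕP.*-monoʳ-≤ 2 (ℤP.∣i-j∣≤∣i∣+∣j∣ T₁ T₀) ⟩
    2 ℕ.* (∣ T₁ ∣ ℕ.+ ∣ T₀ ∣)           ≡⟨ ℕP.*-distribˡ-+ 2 ∣ T₁ ∣ ∣ T₀ ∣ ⟩
    2 ℕ.* ∣ T₁ ∣ ℕ.+ 2 ℕ.* ∣ T₀ ∣       <⟨ ℕP.+-mono-< (Tr-bound (suc r) x) (Tr-bound r x) ⟩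
    p ℕ.^ suc r ℕ.+ p ℕ.^ r             ≡⟨ ℕP.+-comm (p ℕ.* p ℕ.^ r) (p ℕ.^ r) ⟩
    suc p ℕ.* p ℕ.^ r                   ∎)
    where
    open ℕP.≤-Reasoning
    r = shift x; T₁ = Tr p (suc r) x; T₀ = Tr p r x

  a₀≢0⇒p∤ : ∀ {x} → Coherent p x → a₀ p x ≢ 0ℤ → p∤ a₀ p x
  a₀≢0⇒p∤ {x} coh a₀≢0 = p∤-small (ℕP.n≢0⇒n>0 (a₀≢0 ∘ ℤP.∣i∣≡0⇒i≡0)) ∣a₀∣<p
    where
    ∣a₀∣<p : ∣ a₀ p x ∣ ℕ.< p
    ∣a₀∣<p = ℕP.*-cancelˡ-< 2 _ _ (ℕP.<-≤-trans (a₀-bound {x} coh) 1+p≤2p)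
      where 1+p≤2p = subst (suc p ℕ.≤_) (cong (p ℕ.+_) (sym (ℕP.+-identityʳ p))) (ℕP.+-monoˡ-≤ p (ℕP.<⇒≤ 1<p))

  -- For x = p^(-r) X this says X ≡ p^r w (mod p^(r+1)): x ∈ ℤ_p and x ≡ w (mod p).
  infix 4 _≡ᵠ_
  record _≡ᵠ_ (x : Qp) (w : ℤ) : Set where
    constructor residue
    field leading : ∀ K → suc (shift x) ℕ.≤ K → seq x K ≡ p^ shift x * w [p^ suc (shift x) ]
  open _≡ᵠ_ public

  ≡ᵠ-at : ∀ {x w K} → Coherent p x → suc (shift x) ℕ.≤ K →
          seq x K ≡ p^ shift x * w [p^ suc (shift x) ] → x ≡ᵠ w
  ≡ᵠ-at {x} coh K≥ x≡ = residue λ K′ K′≥ →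
    ≡[p^]-trans (coherent-≤ {x} coh K′≥) (≡[p^]-trans (≡[p^]-sym (coherent-≤ {x} coh K≥)) x≡)

  ≡ᵠ-cong : ∀ {x v w} → v ≡ w [p^ 1 ] → x ≡ᵠ v → x ≡ᵠ w
  ≡ᵠ-cong {x} v≡w x≡v = residue λ K K≥ → ≡[p^]-trans (leading x≡v K K≥) (≡[p^]-cast (ℕP.+-comm (shift x) 1) (*p^-cong (shift x) v≡w))

  ≡ᵠ-digits : ∀ {x w} → Coherent p x → x ≡ᵠ w →
              (Tr p (shift x) x ≡ 0ℤ) × (Tr p (suc (shift x)) x ≡ p^ shift x * a₀ p x) × (a₀ p x ≡ w [p^ 1 ])
  ≡ᵠ-digits {x} {w} coh x≡w = T₀≡0 , T₁≡ , a₀≡w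
    where
    r = shift x
    X≡ : seq x (suc r) ≡ p^ r * w [p^ suc r ]
    X≡ = leading x≡w (suc r) ℕP.≤-refl
    T₀≡0 : Tr p r x ≡ 0ℤ
    T₀≡0 = Tr-≡0 {r} {x} (≡[p^]-trans (Tr-≤ {x} coh (ℕP.n≤1+n r))
                                     (≡[p^]-trans (≡[p^]-weaken (ℕP.n≤1+n r) X≡) (p^*≡0 w)))
    T₁≡ : Tr p (suc r) x ≡ p^ r * a₀ p x
    T₁≡ = begin
      Tr p (suc r) x                 ≡⟨ sym (ℤP.+-identityʳ _) ⟩
      Tr p (suc r) x - 0ℤ            ≡⟨ cong (λ T → Tr p (suc r) x - T) (sym T₀≡0) ⟩
      Tr p (suc r) x - Tr p r x      ≡⟨ sym (digit-telescopes {x} coh r) ⟩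
      a₀ p x * p^ r                  ≡⟨ ℤP.*-comm (a₀ p x) (p^ r) ⟩
      p^ r * a₀ p x                  ∎
      where open ≡-Reasoning
    a₀≡w : a₀ p x ≡ w [p^ 1 ]
    a₀≡w = *p^-cancel r (≡[p^]-cast (sym (ℕP.+-comm r 1))
             (subst (_≡ p^ r * w [p^ suc r ]) T₁≡ (≡[p^]-trans (Tr-congruent (suc r) x) X≡)))

  unit-normal-form : ∀ {x d} → Coherent p x → x ≡ᵠ d → p∤ d → x ≡ᵠ a₀ p x × p∤ a₀ p x
  unit-normal-form {x} coh x≡d p∤d = ≡ᵠ-cong (≡[p^]-sym a₀≡d) x≡d , p∤-cong a₀≡d p∤d
    where a₀≡d = proj₂ (proj₂ (≡ᵠ-digits {x} coh x≡d))

  s-≡ᵠ-a₀ : ∀ {x w} → Coherent p x → x ≡ᵠ w → ι (sQ p x) ≡ᵠ a₀ p x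
  s-≡ᵠ-a₀ {x} coh x≡w = residue λ _ _ → ≡⇒≡[p^] (trans (num-sQ {x} coh) (proj₁ (proj₂ (≡ᵠ-digits {x} coh x≡w))))

  ≡ᵠ⇒val0 : ∀ {x w} → x ≡ᵠ w → p∤ w → ValQp p x 0ℤ
  ≡ᵠ⇒val0 {x} {w} x≡w p∤w = r , ≡0⇒∣ᵤ X≡0 , X≢0 ∘ ∣ᵤ⇒≡0 , ℤP.+-inverseʳ (+ r)
    where
    r = shift x
    X≡ : seq x (suc r) ≡ p^ r * w [p^ suc r ]
    X≡ = leading x≡w (suc r) ℕP.≤-refl
    X≡0 : seq x (suc r) ≡ 0ℤ [p^ r ]
    X≡0 = ≡[p^]-trans (≡[p^]-weaken (ℕP.n≤1+n r) X≡) (p^*≡0 w)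
    X≢0 : ¬ seq x (suc r) ≡ 0ℤ [p^ suc r ]
    X≢0 X≡0′ = p∤w (*p^-≡0-cancel r (≡[p^]-cast (sym (ℕP.+-comm r 1)) (≡[p^]-trans (≡[p^]-sym X≡) X≡0′)))

  val0⇒p∤ : ∀ {x w} → x ≡ᵠ w → ValQp p x 0ℤ → p∤ w
  val0⇒p∤ {x} {w} x≡w (m , _ , X≢0 , m-r≡0) w≡0 with ℤP.+-injective (ℤP.i-j≡0⇒i≡j (+ m) (+ shift x) m-r≡0)
  ... | refl = X≢0 (≡0⇒∣ᵤ (≡[p^]-trans (leading x≡w (suc m) ℕP.≤-refl)
                                       (≡[p^]-cast (ℕP.+-comm m 1) (*p^-≡0 m w≡0))))

  valuation-below : ∀ r x → ¬ x ≡ 0ℤ [p^ r ] →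
                    Σ ℕ λ m → m ℕ.< r × x ≡ 0ℤ [p^ m ] × ¬ x ≡ 0ℤ [p^ suc m ]
  valuation-below zero    x x≢0 = contradiction (≡0[p^0] x) x≢0
  valuation-below (suc r) x x≢0 with ≡0?[p^ r ] x
  ... | yes x≡0 = r , ℕP.n<1+n r , x≡0 , x≢0
  ... | no  x≢0′ with m , m<r , x≡0 , x≢0″ ← valuation-below r x x≢0′ =
    m , ℕP.m<n⇒m<1+n m<r , x≡0 , x≢0″

  val-negative : ∀ b → ¬ num b ≡ 0ℤ [p^ dexp b ] → Σ ℤ λ k → k ℤ.< 0ℤ × ValDy p b k
  val-negative b b∉ℤₚ with m , m<e , b≡0 , b≢0 ← valuation-below (dexp b) (num b) b∉ℤₚ =
    + m - + dexp b , m<n⇒m-n<0 m<e , m , ≡0⇒∣ᵤ b≡0 , b≢0 ∘ ∣ᵤ⇒≡0 , refl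

  sub-≡ᵠ : ∀ {x b d β} → x ≡ᵠ d → ι b ≡ᵠ β → subQ p x (ι b) ≡ᵠ d - β
  sub-≡ᵠ {x} {b} {d} {β} x≡d b≡β = residue λ K K≥ →
    subst (_ ≡_[p^ suc (r ℕ.+ e) ]) (lemma (p^ r) (p^ e) d β (p^-+ r e))
      (–-cong (≡[p^]-cast (trans (ℕP.+-suc e r) (cong suc (ℕP.+-comm e r)))
                          (*p^-cong e (leading x≡d K (ℕP.≤-trans (ℕ.s≤s (ℕP.m≤m+n r e)) K≥))))
              (≡[p^]-cast (ℕP.+-suc r e) (*p^-cong r (leading b≡β (suc e) ℕP.≤-refl))))
    where
    r = shift x; e = dexp b
    lemma : ∀ Pr Pe d β {Pre} → Pre ≡ Pr * Pe → Pe * (Pr * d) - Pr * (Pe * β) ≡ Pre * (d - β)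
    lemma Pr Pe d β refl = solve (Pr ∷ Pe ∷ d ∷ β ∷ [])

  addInt-≡ᵠ : ∀ {b β} z → ι b ≡ᵠ β → ι (addIntDy p b z) ≡ᵠ β + z
  addInt-≡ᵠ {b} {β} z b≡β = residue λ K K≥ →
    subst (_ ≡_[p^ _ ]) (lemma (p^ dexp b) β z) (+-cong (leading b≡β K K≥) ≡[p^]-refl)
    where lemma : ∀ P β z → P * β + z * P ≡ P * (β + z)
          lemma P β z = solve (P ∷ β ∷ z ∷ [])

  mul-≡ᵠ : ∀ {b b′ β β′} → ι b′ ≡ᵠ β′ → ι b ≡ᵠ β → ι (mulDy b′ b) ≡ᵠ β′ * β
  mul-≡ᵠ {b} {b′} {β} {β′} b′≡β′ b≡β = residue λ _ _ → product
    where
    e = dexp b; e′ = dexp b′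
    lemma : ∀ P′ P u′ u {P″} → P″ ≡ P′ * P → (P′ * u′) * (P * u) ≡ P″ * (u′ * u)
    lemma P′ P u′ u refl = solve (P′ ∷ P ∷ u′ ∷ u ∷ [])
    product : num b′ * num b ≡ p^ (e′ ℕ.+ e) * (β′ * β) [p^ suc (e′ ℕ.+ e) ]
    product
      with u′ , B′≡ , u′≡β′ ← leading-digit (leading b′≡β′ (suc (dexp b′)) ℕP.≤-refl)
      with u  , B≡  , u≡β   ← leading-digit (leading b≡β (suc (dexp b)) ℕP.≤-refl) =
        subst (_≡ p^ (e′ ℕ.+ e) * (β′ * β) [p^ suc (e′ ℕ.+ e) ])
            (sym (trans (cong₂ _*_ B′≡ B≡) (lemma (p^ e′) (p^ e) u′ u (p^-+ e′ e))))
            (≡[p^]-cast (ℕP.+-comm (e′ ℕ.+ e) 1) (*p^-cong (e′ ℕ.+ e) (*-cong u′≡β′ u≡β)))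

  -- Reciprocals

  reciprocal-∉ℤₚ : ∀ {a c} → Coherent p a → mulQ a c ≈[ p ] oneQ → c ≡ᵠ 0ℤ →
                   ¬ Tr p (shift a) a ≡ 0ℤ [p^ shift a ]
  reciprocal-∉ℤₚ {a} {c} coh a*c≈1 c≡0 T≡0 =
    p^[1+k]∤p^k (r ℕ.+ hc) (≡[p^]-trans (≡[p^]-sym (inverse-congruent {a} {c} a*c≈1 K)) A*C≡0)
    where
    r = shift a; hc = shift c; K = suc (r ℕ.+ hc)
    A≡0 : seq a K ≡ 0ℤ [p^ r ]
    A≡0 = ≡[p^]-trans (≡[p^]-sym (Tr-≤ {a} coh (ℕP.m≤n⇒m≤1+n (ℕP.m≤m+n r hc)))) T≡0
    C≡0 : seq c K ≡ 0ℤ [p^ suc hc ]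
    C≡0 = subst (seq c K ≡_[p^ suc hc ]) (ℤP.*-zeroʳ (p^ hc)) (leading c≡0 K (ℕ.s≤s (ℕP.m≤n+m hc r)))
    A*C≡0 : seq a K * seq c K ≡ 0ℤ [p^ K ]
    A*C≡0 = ≡[p^]-cast (ℕP.+-suc r hc) (*-≡0 A≡0 C≡0)

  *p^u-cancel : ∀ r h {A u} → A * (p^ h * u) ≡ p^ (r ℕ.+ h) [p^ suc (r ℕ.+ h) ] → A * u ≡ p^ r [p^ suc r ]
  *p^u-cancel r h {A} {u} c = *p^-cancel h (≡[p^]-cast (trans (cong suc (ℕP.+-comm r h)) (sym (ℕP.+-suc h r)))
    (subst₂ (_≡_[p^ _ ]) (lemma A (p^ h) u) (trans (p^-+ r h) (ℤP.*-comm (p^ r) (p^ h))) c))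
    where lemma : ∀ A P u → A * (P * u) ≡ P * (A * u)
          lemma A P u = solve (A ∷ P ∷ u ∷ [])

  unit-cofactor : ∀ r h {A u} → p∤ u → A * (p^ h * u) ≡ p^ (r ℕ.+ h) [p^ suc (r ℕ.+ h) ] →
                  Σ ℤ λ d → (A ≡ p^ r * d) × (d * u ≡ 1ℤ [p^ 1 ])
  unit-cofactor r h {A} {u} p∤u A*p^hu≡p^r+h = d , A≡p^rd , d*u≡1
    where
    A*u≡p^r : A * u ≡ p^ r [p^ suc r ]
    A*u≡p^r = *p^u-cancel r h {A} {u} A*p^hu≡p^r+h
    A≡0 : A ≡ 0ℤ [p^ r ]
    A≡0 = p∤-cancel p∤u r {A} (≡[p^]-trans (≡[p^]-weaken (ℕP.n≤1+n r) A*u≡p^r) (p^≡0 r))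
    d = proj₁ (≡0⇒p^* {r} {A} A≡0)
    A≡p^rd : A ≡ p^ r * d
    A≡p^rd = proj₂ (≡0⇒p^* {r} {A} A≡0)
    d*u≡1 : d * u ≡ 1ℤ [p^ 1 ]
    d*u≡1 = *p^-cancel r {1} {d * u} {1ℤ} (≡[p^]-cast (sym (ℕP.+-comm r 1))
              (subst₂ (_≡_[p^ suc r ]) (trans (cong (_* u) A≡p^rd) (ℤP.*-assoc (p^ r) d u))
                                       (sym (ℤP.*-identityʳ (p^ r))) A*u≡p^r))

  reciprocal-≡ᵠ : ∀ {a c w} → Coherent p a → mulQ a c ≈[ p ] oneQ → c ≡ᵠ w → p∤ w →
                  Σ ℤ λ d → a ≡ᵠ d × d * w ≡ 1ℤ [p^ 1 ]
  reciprocal-≡ᵠ {a} {c} {w} coh a*c≈1 c≡w p∤w =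
    d , ≡ᵠ-at {a} {d} {K} coh (ℕ.s≤s (ℕP.m≤m+n r h)) (≡⇒≡[p^] A≡p^rd) , ≡[p^]-trans (*-congˡ d (≡[p^]-sym u≡w)) d*u≡1
    where
    r = shift a; h = shift c; K = suc (r ℕ.+ h)
    leading-c = leading-digit {h} {seq c K} {w} (leading c≡w K (ℕ.s≤s (ℕP.m≤n+m h r)))
    u = proj₁ leading-c
    u≡w : u ≡ w [p^ 1 ]
    u≡w = proj₂ (proj₂ leading-c)
    A*p^hu≡ : seq a K * (p^ h * u) ≡ p^ (r ℕ.+ h) [p^ K ]
    A*p^hu≡ = subst (λ C → seq a K * C ≡ p^ (r ℕ.+ h) [p^ K ]) (proj₁ (proj₂ leading-c)) (inverse-congruent {a} {c} a*c≈1 K)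
    cofactor = unit-cofactor r h {seq a K} {u} (p∤-cong u≡w p∤w) A*p^hu≡
    d = proj₁ cofactor
    A≡p^rd : seq a K ≡ p^ r * d
    A≡p^rd = proj₁ (proj₂ cofactor)
    d*u≡1 : d * u ≡ 1ℤ [p^ 1 ]
    d*u≡1 = proj₂ (proj₂ cofactor)

  -- The differences α - b

  polar-difference : ∀ {x N} c → Coherent p x → N ≡ Tr p (suc (shift x)) x - p^ shift x * c →
                     subQ p x (ι (dy N (shift x))) ≡ᵠ c
  polar-difference {x} {N} c coh N≡ = residue λ K K≥ →
    ≡[p^]-cast (ℕP.+-suc r r) (subst₂ (_≡_[p^ r ℕ.+ suc r ]) (distrib (p^ r) (seq x K) N)
                                                   (trans (sym (ℤP.*-assoc (p^ r) (p^ r) c)) (cong (_* c) (sym (p^-+ r r))))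
                                                   (*p^-cong r (X-N≡p^rc K K≥)))
    where
    r = shift x; T₁ = Tr p (suc r) x
    X-N≡p^rc : ∀ K → suc (r ℕ.+ r) ℕ.≤ K → seq x K - N ≡ p^ r * c [p^ suc r ]
    X-N≡p^rc K K≥ = subst₂ (_≡_[p^ suc r ]) (cong (λ M → seq x K - M) (sym N≡)) (cancel T₁ (p^ r * c))
                 (–-cong (≡[p^]-sym (Tr-≤ {x} coh (ℕP.≤-trans (ℕ.s≤s (ℕP.m≤m+n r r)) K≥))) ≡[p^]-refl)
      where cancel : ∀ T v → T - (T - v) ≡ v
            cancel T v = solve (T ∷ v ∷ [])
    distrib : ∀ P X N → P * (X - N) ≡ P * X - P * N
    distrib P X N = solve (P ∷ X ∷ N ∷ [])

  s-difference : ∀ {x} → Coherent p x → subQ p x (ι (sQ p x)) ≡ᵠ 0ℤ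
  s-difference {x} coh = polar-difference {x} 0ℤ coh (begin
    num (sQ p x)          ≡⟨ num-sQ {x} coh ⟩
    T₁                    ≡⟨ sym (ℤP.+-identityʳ T₁) ⟩
    T₁ - 0ℤ               ≡⟨ cong (λ M → T₁ - M) (sym (ℤP.*-zeroʳ (p^ shift x))) ⟩
    T₁ - p^ shift x * 0ℤ  ∎)
    where open ≡-Reasoning
          T₁ = Tr p (suc (shift x)) x

  t-difference : ∀ {x} → Coherent p x → subQ p x (ι (tQ p x)) ≡ᵠ a₀ p x
  t-difference {x} coh = polar-difference {x} (a₀ p x) coh (num-tQ≡ {x} coh)

  shifted-t-difference : ∀ {x} σ → Coherent p x → subQ p x (ι (addIntDy p (tQ p x) (- σ))) ≡ᵠ a₀ p x + σ
  shifted-t-difference {x} σ coh = polar-difference {x} (a₀ p x + σ) coh (begin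
    num (tQ p x) + - σ * P          ≡⟨ cong (_+ - σ * P) (num-tQ≡ {x} coh) ⟩
    T₁ - P * a₀ p x + - σ * P       ≡⟨ lemma T₁ P (a₀ p x) σ ⟩
    T₁ - P * (a₀ p x + σ)           ∎)
    where
    open ≡-Reasoning
    P = p^ shift x; T₁ = Tr p (suc (shift x)) x
    lemma : ∀ T₁ P a σ → T₁ - P * a + - σ * P ≡ T₁ - P * (a + σ)
    lemma T₁ P a σ = solve (T₁ ∷ P ∷ a ∷ σ ∷ [])

  t-val⇒a₀≢0 : ∀ {x} → Coherent p x → ValQp p (subQ p x (ι (tQ p x))) 0ℤ → a₀ p x ≢ 0ℤ
  t-val⇒a₀≢0 {x} coh v a₀≡0 = val0⇒p∤ (t-difference {x} coh) v (≡⇒≡[p^] a₀≡0)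

  a₀≢0⇒t-val : ∀ {x} → Coherent p x → a₀ p x ≢ 0ℤ → ValQp p (subQ p x (ι (tQ p x))) 0ℤ
  a₀≢0⇒t-val {x} coh a₀≢0 = ≡ᵠ⇒val0 (t-difference {x} coh) (a₀≢0⇒p∤ {x} coh a₀≢0)

  ¬t-val⇒a₀≡0 : ∀ {x} → Coherent p x → ¬ ValQp p (subQ p x (ι (tQ p x))) 0ℤ → a₀ p x ≡ 0ℤ
  ¬t-val⇒a₀≡0 {x} coh ¬v with a₀ p x ℤP.≟ 0ℤ
  ... | yes a₀≡0 = a₀≡0
  ... | no  a₀≢0 = contradiction (a₀≢0⇒t-val {x} coh a₀≢0) ¬v

  phase1-difference : ∀ {alg n x b} → n ℕ.% 3 ≡ 1 → Coherent p x → PQ p alg n x b →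
                      Σ ℤ λ w → subQ p x (ι b) ≡ᵠ w × p∤ w
  phase1-difference {x = x} _ coh (pq1a _ v) = a₀ p x , t-difference {x} coh , val0⇒p∤ (t-difference {x} coh) v
  phase1-difference {x = x} _ coh (pq1b _ ¬v t≢0) =
    σ , subst (subQ p x (ι (addIntDy p (tQ p x) (- σ))) ≡ᵠ_) (trans (cong (_+ σ) (¬t-val⇒a₀≡0 {x} coh ¬v)) (ℤP.+-identityˡ σ))
              (shifted-t-difference {x} σ coh)
      , sgn-p∤ (num (tQ p x)) t≢0
    where σ = sgn (num (tQ p x))
  phase1-difference h _ (pq0 h′)     = phase-clash h h′ λ ()
  phase1-difference h _ (pq2f h′ _)  = phase-clash h h′ λ ()
  phase1-difference h _ (pq2s h′ _)  = phase-clash h h′ λ ()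

  phase1-valuation : ∀ {alg n a b} → n ℕ.% 3 ≡ 1 → Coherent p a → ¬ Tr p (shift a) a ≡ 0ℤ [p^ shift a ] →
                     PQ p alg n a b → Σ ℤ λ k → k ℤ.< 0ℤ × ValDy p b k
  phase1-valuation {a = a} _ coh T≢0 (pq1a _ _) =
    val-negative (tQ p a) (T≢0 ∘ subst (_≡ 0ℤ [p^ shift a ]) (num-tQ {a} coh))
  phase1-valuation {a = a} _ coh T≢0 (pq1b _ _ _) =
    val-negative (addIntDy p (tQ p a) (- σ)) λ t-σ≡0 →
      T≢0 (subst (_≡ 0ℤ [p^ shift a ]) (trans (lemma (num (tQ p a)) (- σ * p^ shift a)) (num-tQ {a} coh))
                 (–-cong t-σ≡0 (subst (- σ * p^ shift a ≡_[p^ shift a ]) (ℤP.*-zeroʳ (- σ))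
                                      (*-congˡ (- σ) (p^≡0 (shift a))))))
    where
    σ = sgn (num (tQ p a))
    lemma : ∀ t s → t + s - s ≡ t
    lemma t s = solve (t ∷ s ∷ [])
  phase1-valuation h _ _ (pq0 h′)     = phase-clash h h′ λ ()
  phase1-valuation h _ _ (pq2f h′ _)  = phase-clash h h′ λ ()
  phase1-valuation h _ _ (pq2s h′ _)  = phase-clash h h′ λ ()

  -- b_{3n+2} mod p, when α_{3n+2} is a unit with leading digit d and e = u(α_{3n+2}).
  phase2-residue : Alg → ℤ → ℤ → ℤ
  phase2-residue first  d e = e
  phase2-residue second d e = d - e

  phase2-quotient-≡ᵠ : ∀ alg {x} e → Coherent p x → x ≡ᵠ a₀ p x →
                       ι (phase2-quotient p alg x e) ≡ᵠ phase2-residue alg (a₀ p x) e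
  phase2-quotient-≡ᵠ first  e _ _ = residue λ _ _ → ≡⇒≡[p^] (sym (ℤP.*-identityˡ e))
  phase2-quotient-≡ᵠ second {x} e coh x≡a₀ = addInt-≡ᵠ (- e) (s-≡ᵠ-a₀ {x} coh x≡a₀)

  phase2-residue-p∤ : ∀ alg {d e} → 2 ℕ.* ∣ d ∣ ℕ.< suc p → uDigit d ≡ just e →
                      p∤ phase2-residue alg d e × p∤ (d - phase2-residue alg d e)
  phase2-residue-p∤ first  {d} {e} bound u≡e = u-p∤ {d} u≡e , digit-minus-u-p∤ {d} bound u≡e
  phase2-residue-p∤ second {d} {e} bound u≡e =
    digit-minus-u-p∤ {d} bound u≡e , p∤-cong (≡⇒≡[p^] (lemma d e)) (u-p∤ {d} u≡e)
    where lemma : ∀ d e → d - (d - e) ≡ e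
          lemma d e = solve (d ∷ e ∷ [])

  b′b+1-unit : ∀ {b b′ β d d′} → ι b ≡ᵠ β → ι b′ ≡ᵠ d′ → d′ * (d - β) ≡ 1ℤ [p^ 1 ] → p∤ d →
               ValDy p (addIntDy p (mulDy b′ b) 1ℤ) 0ℤ
  b′b+1-unit {β = β} {d} {d′} b≡β b′≡d′ d′[d-β]≡1 p∤d =
    ≡ᵠ⇒val0 (≡ᵠ-cong d′β+1≡d′d (addInt-≡ᵠ 1ℤ (mul-≡ᵠ b′≡d′ b≡β))) (p∤-* (p∤-invertible {d′} {d - β} d′[d-β]≡1) p∤d)
    where
    d′β+1≡d′d : d′ * β + 1ℤ ≡ d′ * d [p^ 1 ]
    d′β+1≡d′d = subst (d′ * β + 1ℤ ≡_[p^ 1 ]) (lemma d′ β d)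
                  (+-cong {x = d′ * β} {y = d′ * β} ≡[p^]-refl (≡[p^]-sym d′[d-β]≡1))
      where lemma : ∀ d′ β d → d′ * β + d′ * (d - β) ≡ d′ * d
            lemma d′ β d = solve (d′ ∷ β ∷ d ∷ [])

  -- Determinism of the algorithms

  Tr-invariant : ∀ {x y} → Coherent p x → Coherent p y → x ≈[ p ] y → ∀ j →
                 p^ shift y * Tr p (j ℕ.+ shift x) x ≡ p^ shift x * Tr p (j ℕ.+ shift y) y
  Tr-invariant {x} {y} cx cy x≈y j =
    ≡[p^]∧small⇒≡ (≡[p^]-trans X≡ (≡[p^]-trans (≈⇒≡[p^] {x} {y} x≈y K) (≡[p^]-sym Y≡)))
                  (*p^-bound r′ (Tr-bound (j ℕ.+ r) x))
                  (subst (λ k → 2 ℕ.* ∣ p^ r * Tr p (j ℕ.+ r′) y ∣ ℕ.< p ℕ.^ k) K≡ (*p^-bound r (Tr-bound (j ℕ.+ r′) y)))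
    where
    r = shift x; r′ = shift y; K = r′ ℕ.+ (j ℕ.+ r)
    K≡ : r ℕ.+ (j ℕ.+ r′) ≡ K
    K≡ = solve-ℕ r r′ j
      where solve-ℕ : ∀ r r′ j → r ℕ.+ (j ℕ.+ r′) ≡ r′ ℕ.+ (j ℕ.+ r)
            solve-ℕ r r′ j = ℕS.solve (r ∷ r′ ∷ j ∷ [])
    X≡ : p^ r′ * Tr p (j ℕ.+ r) x ≡ p^ r′ * seq x K [p^ K ]
    X≡ = *p^-cong r′ (Tr-≤ {x} cx (ℕP.m≤n+m (j ℕ.+ r) r′))
    Y≡ : p^ r * Tr p (j ℕ.+ r′) y ≡ p^ r * seq y K [p^ K ]
    Y≡ = ≡[p^]-cast K≡ (*p^-cong r (Tr-≤ {y} cy (subst (j ℕ.+ r′ ℕ.≤_) K≡ (ℕP.m≤n+m (j ℕ.+ r′) r))))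

  a₀-invariant : ∀ {x y} → Coherent p x → Coherent p y → x ≈[ p ] y → a₀ p x ≡ a₀ p y
  a₀-invariant {x} {y} cx cy x≈y = ℤP.*-cancelˡ-≡ (p^ r * p^ r′) (a₀ p x) (a₀ p y) ⦃ P≢0 ⦄ (begin
    p^ r * p^ r′ * a₀ p x            ≡⟨ lemma (p^ r) (p^ r′) (a₀ p x) ⟩
    p^ r′ * (a₀ p x * p^ r)          ≡⟨ cong (p^ r′ *_) (digit-telescopes {x} cx r) ⟩
    p^ r′ * (Tr p (suc r) x - Tr p r x)
                                     ≡⟨ distrib (p^ r′) (Tr p (suc r) x) (Tr p r x) ⟩
    p^ r′ * Tr p (suc r) x - p^ r′ * Tr p r x
                                     ≡⟨ cong₂ _-_ (Tr-invariant {x} {y} cx cy x≈y 1) (Tr-invariant {x} {y} cx cy x≈y 0) ⟩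
    p^ r * Tr p (suc r′) y - p^ r * Tr p r′ y
                                     ≡⟨ distrib (p^ r) (Tr p (suc r′) y) (Tr p r′ y) ⟨
    p^ r * (Tr p (suc r′) y - Tr p r′ y)
                                     ≡⟨ cong (p^ r *_) (digit-telescopes {y} cy r′) ⟨
    p^ r * (a₀ p y * p^ r′)          ≡⟨ lemma′ (p^ r) (p^ r′) (a₀ p y) ⟩
    p^ r * p^ r′ * a₀ p y            ∎)
    where
    open ≡-Reasoning
    r = shift x; r′ = shift y
    P≢0 = subst ℤ.NonZero (p^-+ r r′) (p^≢0 (r ℕ.+ r′))
    lemma : ∀ P P′ a → P * P′ * a ≡ P′ * (a * P)
    lemma P P′ a = solve (P ∷ P′ ∷ a ∷ [])
    lemma′ : ∀ P P′ a → P * (a * P′) ≡ P * P′ * a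
    lemma′ P P′ a = solve (P ∷ P′ ∷ a ∷ [])
    distrib : ∀ P A B → P * (A - B) ≡ P * A - P * B
    distrib P A B = solve (P ∷ A ∷ B ∷ [])

  sgn-*-p^ : ∀ k z → sgn (p^ k * z) ≡ sgn z
  sgn-*-p^ k z with p ℕ.^ k | ℕP.m^n≢0 p k
  ... | suc m | _ with z
  ...   | + zero   = cong sgn (ℤP.*-zeroʳ (+ suc m))
  ...   | +[1+ _ ] = refl
  ...   | -[1+ _ ] = refl

  s-≃ᵈ : ∀ {x y} → Coherent p x → Coherent p y → x ≈[ p ] y → sQ p x ≃ᵈ sQ p y
  s-≃ᵈ {x} {y} cx cy x≈y = cross-equal (begin
    p^ shift y * num (sQ p x)         ≡⟨ cong (p^ shift y *_) (num-sQ {x} cx) ⟩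
    p^ shift y * Tr p (suc (shift x)) x ≡⟨ Tr-invariant {x} {y} cx cy x≈y 1 ⟩
    p^ shift x * Tr p (suc (shift y)) y ≡⟨ cong (p^ shift x *_) (num-sQ {y} cy) ⟨
    p^ shift x * num (sQ p y)         ∎)
    where open ≡-Reasoning

  t-≃ᵈ : ∀ {x y} → Coherent p x → Coherent p y → x ≈[ p ] y → tQ p x ≃ᵈ tQ p y
  t-≃ᵈ {x} {y} cx cy x≈y = cross-equal (begin
    p^ shift y * num (tQ p x)   ≡⟨ cong (p^ shift y *_) (num-tQ {x} cx) ⟩
    p^ shift y * Tr p (shift x) x ≡⟨ Tr-invariant {x} {y} cx cy x≈y 0 ⟩
    p^ shift x * Tr p (shift y) y ≡⟨ cong (p^ shift x *_) (num-tQ {y} cy) ⟨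
    p^ shift x * num (tQ p y)   ∎)
    where open ≡-Reasoning

  shifted-t-≃ᵈ : ∀ {x y} → Coherent p x → Coherent p y → x ≈[ p ] y →
                 addIntDy p (tQ p x) (- sgn (num (tQ p x))) ≃ᵈ addIntDy p (tQ p y) (- sgn (num (tQ p y)))
  shifted-t-≃ᵈ {x} {y} cx cy x≈y =
    subst (λ σ → addIntDy p (tQ p x) (- sgn (num (tQ p x))) ≃ᵈ addIntDy p (tQ p y) (- σ)) sgn≡
          (addInt-≃ᵈ (- sgn (num (tQ p x))) tx≃ty)
    where
    tx≃ty = t-≃ᵈ {x} {y} cx cy x≈y
    sgn≡ : sgn (num (tQ p x)) ≡ sgn (num (tQ p y))
    sgn≡ = trans (sym (sgn-*-p^ (shift y) _)) (trans (cong sgn (cross tx≃ty)) (sgn-*-p^ (shift x) _))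

  phase2-quotient-≃ᵈ : ∀ alg {x y} e → Coherent p x → Coherent p y → x ≈[ p ] y →
                       phase2-quotient p alg x e ≃ᵈ phase2-quotient p alg y e
  phase2-quotient-≃ᵈ first  e cx cy x≈y = cross-equal refl
  phase2-quotient-≃ᵈ second {x} {y} e cx cy x≈y = addInt-≃ᵈ (- e) (s-≃ᵈ {x} {y} cx cy x≈y)

  phase2-deterministic : ∀ {alg n x y b₁ b₂} → n ℕ.% 3 ≡ 2 → Coherent p x → Coherent p y → x ≈[ p ] y →
                         PQ p alg n x b₁ → PQ p alg n y b₂ → ι b₁ ≈[ p ] ι b₂
  phase2-deterministic {alg} {x = x} {y} {b₁} {b₂} h cx cy x≈y q₁ q₂ =
    subst₂ (λ b₁ b₂ → ι b₁ ≈[ p ] ι b₂) (sym (proj₂ (proj₂ q₁-inv))) (sym (proj₂ (proj₂ q₂-inv)))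
      (≃ᵈ⇒ι≈ (subst (λ e → phase2-quotient p alg x e₁ ≃ᵈ phase2-quotient p alg y e) e₁≡e₂
                    (phase2-quotient-≃ᵈ alg e₁ cx cy x≈y)))
    where
    q₁-inv = PQ-phase2 h q₁; q₂-inv = PQ-phase2 h q₂
    e₁ = proj₁ q₁-inv
    e₁≡e₂ : e₁ ≡ proj₁ q₂-inv
    e₁≡e₂ = just-injective (trans (sym (proj₁ (proj₂ q₁-inv)))
                                  (trans (cong uDigit (a₀-invariant {x} {y} cx cy x≈y)) (proj₁ (proj₂ q₂-inv))))

  PQ-deterministic : ∀ {alg n x y b₁ b₂} → Coherent p x → Coherent p y → x ≈[ p ] y →
                     PQ p alg n x b₁ → PQ p alg n y b₂ → ι b₁ ≈[ p ] ι b₂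
  PQ-deterministic {x = x} {y} cx cy x≈y (pq0 h) q₂ with refl ← PQ-phase0 h q₂ = ≃ᵈ⇒ι≈ (s-≃ᵈ {x} {y} cx cy x≈y)
  PQ-deterministic {x = x} {y} cx cy x≈y (pq1a _ _) (pq1a _ _) = ≃ᵈ⇒ι≈ (t-≃ᵈ {x} {y} cx cy x≈y)
  PQ-deterministic {x = x} {y} cx cy x≈y (pq1a _ v) (pq1b _ ¬v _) =
    contradiction (a₀≢0⇒t-val {y} cy (λ a₀≡0 → t-val⇒a₀≢0 {x} cx v (trans (a₀-invariant {x} {y} cx cy x≈y) a₀≡0))) ¬v
  PQ-deterministic {x = x} {y} cx cy x≈y (pq1b _ ¬v _) (pq1a _ v) =
    contradiction (a₀≢0⇒t-val {x} cx (λ a₀≡0 → t-val⇒a₀≢0 {y} cy v (trans (sym (a₀-invariant {x} {y} cx cy x≈y)) a₀≡0))) ¬v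
  PQ-deterministic {x = x} {y} cx cy x≈y (pq1b _ _ _) (pq1b _ _ _) = ≃ᵈ⇒ι≈ (shifted-t-≃ᵈ {x} {y} cx cy x≈y)
  PQ-deterministic _ _ _ (pq1a h _)   (pq0 h′)       = phase-clash h h′ λ ()
  PQ-deterministic _ _ _ (pq1a h _)   (pq2f h′ _)    = phase-clash h h′ λ ()
  PQ-deterministic _ _ _ (pq1a h _)   (pq2s h′ _)    = phase-clash h h′ λ ()
  PQ-deterministic _ _ _ (pq1b h _ _) (pq0 h′)       = phase-clash h h′ λ ()
  PQ-deterministic _ _ _ (pq1b h _ _) (pq2f h′ _)    = phase-clash h h′ λ ()
  PQ-deterministic _ _ _ (pq1b h _ _) (pq2s h′ _)    = phase-clash h h′ λ ()
  PQ-deterministic cx cy x≈y q₁@(pq2f h _) q₂ = phase2-deterministic h cx cy x≈y q₁ q₂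
  PQ-deterministic cx cy x≈y q₁@(pq2s h _) q₂ = phase2-deterministic h cx cy x≈y q₁ q₂

  module _ {alg : Alg} {α : Qp} (α-coh : Coherent p α) where

    Run-coherent : ∀ {n a} → Run p alg α n a → Coherent p a
    Run-coherent start                = α-coh
    Run-coherent (next _ _ _ coh _)   = coh

    Run-deterministic : ∀ {n a₁ a₂} → Run p alg α n a₁ → Run p alg α n a₂ → a₁ ≈[ p ] a₂
    Run-deterministic start start = ≈-refl {α}
    Run-deterministic {a₁ = a₁} {a₂} (next {a = x₁} {b = b₁} r₁ q₁ _ coh₁ inv₁) (next {a = x₂} {b = b₂} r₂ q₂ _ coh₂ inv₂) =
      inverse-unique {a₁} {a₂} {subQ p x₁ (ι b₁)} {subQ p x₂ (ι b₂)} coh₁ coh₂ inv₁ inv₂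
        (subQ-cong {x₁} {x₂} {ι b₁} {ι b₂} x₁≈x₂ (PQ-deterministic (Run-coherent r₁) (Run-coherent r₂) x₁≈x₂ q₁ q₂))
      where x₁≈x₂ = Run-deterministic r₁ r₂

    α₃ₙ₊₂-unit : ∀ n {a} → Run p alg α (2 ℕ.+ 3 ℕ.* n) a → a ≡ᵠ a₀ p a × p∤ a₀ p a
    α₃ₙ₊₂-unit n {a} (next {a = x} {b = b} r q _ coh inv) =
      unit-normal-form {a} coh (proj₁ (proj₂ recip)) (p∤-invertible (proj₂ (proj₂ recip)))
      where
      diff = phase1-difference ([r+3n]%3≡r%3 1 n) (Run-coherent r) q
      recip = reciprocal-≡ᵠ {a} {subQ p x (ι b)} {proj₁ diff} coh inv (proj₁ (proj₂ diff)) (proj₂ (proj₂ diff))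

    record α₃ₙ₊₃-Unit (n : ℕ) (a′ : Qp) : Set where
      field
        α₃ₙ₊₂      : Qp
        run₃ₙ₊₂    : Run p alg α (2 ℕ.+ 3 ℕ.* n) α₃ₙ₊₂
        u₃ₙ₊₂      : ℤ
        u≡u₃ₙ₊₂    : uQ p α₃ₙ₊₂ ≡ just u₃ₙ₊₂
        a′≡a₀      : a′ ≡ᵠ a₀ p a′
        a₀-inverse : a₀ p a′ * (a₀ p α₃ₙ₊₂ - phase2-residue alg (a₀ p α₃ₙ₊₂) u₃ₙ₊₂) ≡ 1ℤ [p^ 1 ]

    α₃ₙ₊₃-unit : ∀ n {a′} → Run p alg α (3 ℕ.+ 3 ℕ.* n) a′ → α₃ₙ₊₃-Unit n a′
    α₃ₙ₊₃-unit n {a′} (next {a = x} {b = b} r q _ coh inv) = record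
      { α₃ₙ₊₂      = x
      ; run₃ₙ₊₂    = r
      ; u₃ₙ₊₂      = e
      ; u≡u₃ₙ₊₂    = u≡e
      ; a′≡a₀      = proj₁ (unit-normal-form {a′} coh a′≡d (p∤-invertible {d} {w} dw≡1))
      ; a₀-inverse = ≡[p^]-trans (*-congʳ w (proj₂ (proj₂ (≡ᵠ-digits {a′} coh a′≡d)))) dw≡1
      }
      where
      x-coh = Run-coherent r
      x≡a₀ = proj₁ (α₃ₙ₊₂-unit n r)
      q-inv = PQ-phase2 ([r+3n]%3≡r%3 2 n) q
      e = proj₁ q-inv
      u≡e = proj₁ (proj₂ q-inv)
      w = a₀ p x - phase2-residue alg (a₀ p x) e
      x-b≡w : subQ p x (ι b) ≡ᵠ w
      x-b≡w = subst (λ b → subQ p x (ι b) ≡ᵠ w) (sym (proj₂ (proj₂ q-inv)))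
                    (sub-≡ᵠ {x} x≡a₀ (phase2-quotient-≡ᵠ alg e x-coh x≡a₀))
      recip = reciprocal-≡ᵠ {a′} {subQ p x (ι b)} {w} coh inv x-b≡w
                (proj₂ (phase2-residue-p∤ alg {a₀ p x} {e} (a₀-bound {x} x-coh) u≡e))
      d = proj₁ recip
      a′≡d = proj₁ (proj₂ recip)
      dw≡1 = proj₂ (proj₂ recip)

    b₃ₙ₊₁-negative : (n : ℕ) (a : Qp) (b : Dy) →
                     Run p alg α (3 ℕ.* n ℕ.+ 1) a → PQ p alg (3 ℕ.* n ℕ.+ 1) a b →
                     Σ ℤ λ k → (k ℤ.< 0ℤ) × ValDy p b k
    b₃ₙ₊₁-negative n a b rewrite ℕP.+-comm (3 ℕ.* n) 1 = negative
      where
      negative : Run p alg α (1 ℕ.+ 3 ℕ.* n) a → PQ p alg (1 ℕ.+ 3 ℕ.* n) a b → Σ ℤ λ k → (k ℤ.< 0ℤ) × ValDy p b k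
      negative (next {a = x} {b = b₀} r q _ coh inv) =
        phase1-valuation ([r+3n]%3≡r%3 1 n) coh
          (reciprocal-∉ℤₚ {a} {subQ p x (ι (sQ p x))} coh
             (subst (λ b₀ → mulQ a (subQ p x (ι b₀)) ≈[ p ] oneQ) (PQ-phase0 ([r+3n]%3≡r%3 0 n) q) inv)
             (s-difference {x} (Run-coherent r)))

    b₃ₙ₊₂-unit : (n : ℕ) (a : Qp) (b : Dy) →
                 Run p alg α (3 ℕ.* n ℕ.+ 2) a → PQ p alg (3 ℕ.* n ℕ.+ 2) a b → ValDy p b 0ℤ
    b₃ₙ₊₂-unit n a b rewrite ℕP.+-comm (3 ℕ.* n) 2 = unit
      where
      unit : Run p alg α (2 ℕ.+ 3 ℕ.* n) a → PQ p alg (2 ℕ.+ 3 ℕ.* n) a b → ValDy p b 0ℤ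
      unit r q = subst (λ b → ValDy p b 0ℤ) (sym (proj₂ (proj₂ q-inv)))
                   (≡ᵠ⇒val0 (phase2-quotient-≡ᵠ alg e (Run-coherent r) (proj₁ (α₃ₙ₊₂-unit n r)))
                            (proj₁ (phase2-residue-p∤ alg {a₀ p a} {e} (a₀-bound {a} (Run-coherent r)) (proj₁ (proj₂ q-inv)))))
        where
        q-inv = PQ-phase2 ([r+3n]%3≡r%3 2 n) q
        e = proj₁ q-inv

    b₃ₙ₊₃-unit : (n : ℕ) (a : Qp) (b : Dy) →
                 Run p alg α (3 ℕ.* n ℕ.+ 3) a → PQ p alg (3 ℕ.* n ℕ.+ 3) a b → ValDy p b 0ℤ
    b₃ₙ₊₃-unit n a b rewrite ℕP.+-comm (3 ℕ.* n) 3 = unit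
      where
      unit : Run p alg α (3 ℕ.+ 3 ℕ.* n) a → PQ p alg (3 ℕ.+ 3 ℕ.* n) a b → ValDy p b 0ℤ
      unit r q = subst (λ b → ValDy p b 0ℤ) (sym (PQ-phase0 ([r+3n]%3≡r%3 3 n) q))
                   (≡ᵠ⇒val0 (s-≡ᵠ-a₀ {a} (Run-coherent r) a′≡a₀) (p∤-invertible a₀-inverse))
        where open α₃ₙ₊₃-Unit (α₃ₙ₊₃-unit n r)

    b₃ₙ₊₃b₃ₙ₊₂+1-unit : (n : ℕ) (a a′ : Qp) (b b′ : Dy) →
                        Run p alg α (3 ℕ.* n ℕ.+ 2) a → PQ p alg (3 ℕ.* n ℕ.+ 2) a b →
                        Run p alg α (3 ℕ.* n ℕ.+ 3) a′ → PQ p alg (3 ℕ.* n ℕ.+ 3) a′ b′ →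
                        ValDy p (addIntDy p (mulDy b′ b) 1ℤ) 0ℤ
    b₃ₙ₊₃b₃ₙ₊₂+1-unit n a a′ b b′ rewrite ℕP.+-comm (3 ℕ.* n) 2 | ℕP.+-comm (3 ℕ.* n) 3 = unit
      where
      unit : Run p alg α (2 ℕ.+ 3 ℕ.* n) a → PQ p alg (2 ℕ.+ 3 ℕ.* n) a b →
             Run p alg α (3 ℕ.+ 3 ℕ.* n) a′ → PQ p alg (3 ℕ.+ 3 ℕ.* n) a′ b′ →
             ValDy p (addIntDy p (mulDy b′ b) 1ℤ) 0ℤ
      unit r q r′ q′ =
        subst₂ (λ b b′ → ValDy p (addIntDy p (mulDy b′ b) 1ℤ) 0ℤ) (sym b≡) (sym (PQ-phase0 ([r+3n]%3≡r%3 3 n) q′))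
          (b′b+1-unit (phase2-quotient-≡ᵠ alg e (Run-coherent r) (proj₁ a-unit)) (s-≡ᵠ-a₀ {a′} (Run-coherent r′) a′≡a₀)
                      inverse (proj₂ a-unit))
        where
        open α₃ₙ₊₃-Unit (α₃ₙ₊₃-unit n r′)
        a-unit = α₃ₙ₊₂-unit n r
        q-inv = PQ-phase2 ([r+3n]%3≡r%3 2 n) q
        e = proj₁ q-inv
        b≡ = proj₂ (proj₂ q-inv)
        a₀≡ : a₀ p a ≡ a₀ p α₃ₙ₊₂
        a₀≡ = a₀-invariant {a} {α₃ₙ₊₂} (Run-coherent r) (Run-coherent run₃ₙ₊₂) (Run-deterministic r run₃ₙ₊₂)
        u₃ₙ₊₂≡e : u₃ₙ₊₂ ≡ e
        u₃ₙ₊₂≡e = just-injective (trans (sym u≡u₃ₙ₊₂) (trans (cong uDigit (sym a₀≡)) (proj₁ (proj₂ q-inv))))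
        inverse : a₀ p a′ * (a₀ p a - phase2-residue alg (a₀ p a) e) ≡ 1ℤ [p^ 1 ]
        inverse = subst₂ (λ d e → a₀ p a′ * (d - phase2-residue alg d e) ≡ 1ℤ [p^ 1 ]) (sym a₀≡) u₃ₙ₊₂≡e a₀-inverse

proposition5p4 : (p : ℕ) → Prime p → p ℕ.% 2 ≡ 1 →
    (alg : Alg) → (α : Qp) → Coherent p α →
    ((n : ℕ) → (a : Qp) → (b : Dy) →
    Run p alg α (3 ℕ.* n ℕ.+ 1) a → PQ p alg (3 ℕ.* n ℕ.+ 1) a b →
    Σ ℤ λ k → (k ℤ.< 0ℤ) × ValDy p b k)
    × ((n : ℕ) → (a : Qp) → (b : Dy) →
    Run p alg α (3 ℕ.* n ℕ.+ 2) a → PQ p alg (3 ℕ.* n ℕ.+ 2) a b →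
    ValDy p b 0ℤ)
    × ((n : ℕ) → (a : Qp) → (b : Dy) →
    Run p alg α (3 ℕ.* n ℕ.+ 3) a → PQ p alg (3 ℕ.* n ℕ.+ 3) a b →
    ValDy p b 0ℤ)
    × ((n : ℕ) → (a a' : Qp) → (b b' : Dy) →
    Run p alg α (3 ℕ.* n ℕ.+ 2) a → PQ p alg (3 ℕ.* n ℕ.+ 2) a b →
    Run p alg α (3 ℕ.* n ℕ.+ 3) a' → PQ p alg (3 ℕ.* n ℕ.+ 3) a' b' →
    ValDy p (addIntDy p (mulDy b' b) 1ℤ) 0ℤ)
proposition5p4 p p-prime p-odd alg α α-coh =
  b₃ₙ₊₁-negative α-coh , b₃ₙ₊₂-unit α-coh , b₃ₙ₊₃-unit α-coh , b₃ₙ₊₃b₃ₙ₊₂+1-unit α-coh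
  where open OddPrime p p-prime p-odd
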